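{- For all integers $n\geq 0$, $sp(n)=oc(n)$, and their common generating function is $$\sum_{n\ge 0} sp(n)x^n = 1+\sum_{i=0}^{\infty}\frac{x^{2^i}}{1-x^{2^{i+1}}}\prod_{t=0}^{i-1}\left(1+\frac{2x^{2^t}}{1-x^{2^{t+1}}}\right)=\sum_{n\ge 0} oc(n)x^n.$$
   Context: Semi-Pell compositions: define sets $SP(n)$ of compositions of $n$ recursively by $SP(1)=\{(1)\}$, $SP(2)=\{(2)\}$; for even $n>2$, $SP(n)$ consists of the compositions in $SP(n/2)$ with every part doubled; for odd $n>2$, $SP(n)$ consists of the compositions obtained by inserting a part $1$ at the beginning or at the end of each composition in $SP(n-1)$, together with the compositions obtained by adding $2$ to the odd part of each composition in $SP(n-2)$ (each such composition has exactly one odd part). Let $sp(n)=|SP(n)|$ for $n\ge1$, $sp(0)=1$. Equivalently $sp(0)=sp(1)=1$ and for $n>1$, $sp(n)=sp(n/2)$ if $n$ is even and $sp(n)=2sp(n-1)+sp(n-2)$ if $n$ is odd. $oc(n)$ is the number of weakly unimodal compositions of $n$ into powers of $2$ in which each part size that occurs appears in a single block of consecutive positions and an odd number of times ($oc(0)=1$). A composition is weakly unimodal if it has the form $(a_1,\dots,a_r,c,b_s,\dots,b_1)$ with $a_1\le\cdots\le a_r\le c>b_s\ge\cdots\ge b_1\ge1$ (the $a$'s or $b$'s may be absent). -}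

module Defs where

open import Data.Nat using (ℕ; zero; suc; _+_; _*_; _∸_; _^_; _≤_; _<_; _>_; _≥_)
open import Data.Nat.DivMod using (_/_; _%_)
open import Data.Nat.Divisibility using (_∣_; _∣?_)
open import Data.Bool using (if_then_else_)
open import Data.Nat.ListAction using (sum)
open import Data.List using (List; []; _∷_; _++_; [_]; length; replicate; upTo; foldr; map)
open import Data.List.Relation.Unary.All using (All)
open import Data.List.Relation.Unary.Linked using (Linked)
open import Data.List.Relation.Unary.Unique.Propositional using (Unique)
open import Data.List.Membership.Propositional using (_∈_; _∉_)
open import Data.Product using (Σ; ∃; ∃-syntax; _×_; _,_)
open import Data.Sum using (_⊎_)
open import Function.Bundles using (_⇔_)
open import Relation.Nullary using (¬_; does)
open import Relation.Binary.PropositionalEquality using (_≡_)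

-- Semi-Pell numbers sp(n):
--   sp 0 = sp 1 = 1, sp n = sp (n/2) for even n > 1,
--   sp n = 2 sp(n-1) + sp(n-2) for odd n > 1.
-- Defined with fuel; fuel (suc n) is always enough since every recursive
-- call is on a strictly smaller argument.

spFuel : ℕ → ℕ → ℕ
spFuel zero _ = 0
spFuel (suc f) zero = 1
spFuel (suc f) (suc zero) = 1
spFuel (suc f) (suc (suc m)) with suc (suc m) % 2
... | zero  = spFuel f (suc (suc m) / 2)
... | suc _ = 2 * spFuel f (suc m) + spFuel f m

sp : ℕ → ℕ
sp n = spFuel (suc n) n

IsPowerOf2 : ℕ → Set
IsPowerOf2 p = ∃[ k ] p ≡ 2 ^ k

Odd : ℕ → Set
Odd m = ¬ (2 ∣ m)

_≥′_ : ℕ → ℕ → Set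
m ≥′ n = n ≤ m

WeaklyUnimodal : List ℕ → Set
WeaklyUnimodal xs =
  xs ≡ [] ⊎
  (Σ (List ℕ) λ as → Σ ℕ λ c → Σ (List ℕ) λ bs →
     xs ≡ as ++ c ∷ bs
     × Linked _≤_ (as ++ [ c ])
     × All (λ b → b < c) bs
     × Linked _≥′_ bs)

SingleOddBlocks : List ℕ → Set
SingleOddBlocks xs =
  ∀ v → v ∈ xs →
    Σ (List ℕ) λ p → Σ ℕ λ m → Σ (List ℕ) λ q →
      xs ≡ p ++ replicate m v ++ q × v ∉ p × v ∉ q × Odd m

OCComposition : ℕ → List ℕ → Set
OCComposition n xs =
  sum xs ≡ n × All IsPowerOf2 xs × WeaklyUnimodal xs × SingleOddBlocks xs

HasCount : (List ℕ → Set) → ℕ → Set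
HasCount P k =
  Σ (List (List ℕ)) λ L → Unique L × (∀ xs → (xs ∈ L ⇔ P xs)) × length L ≡ k

-- Formal power series with natural-number coefficients: f n = [xⁿ] f.

Series : Set
Series = ℕ → ℕ

𝟙 : Series
𝟙 zero = 1
𝟙 (suc _) = 0

X^ : ℕ → Series
X^ k n = if does (n Data.Nat.≟ k) then 1 else 0

_⊕_ : Series → Series → Series
(f ⊕ g) n = f n + g n

_·_ : ℕ → Series → Series
(c · f) n = c * f n

_⊗_ : Series → Series → Series
(f ⊗ g) n = sum (map (λ k → f k * g (n ∸ k)) (upTo (suc n)))

-- 1 / (1 - x^m) = Σ_j x^{m j}   (used only with m ≥ 1)
geom : ℕ → Series
geom m n = if does (m ∣? n) then 1 else 0

Σ< : ℕ → (ℕ → Series) → Series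
Σ< i F = foldr (λ t acc → F t ⊕ acc) (λ _ → 0) (upTo i)

Π< : ℕ → (ℕ → Series) → Series
Π< i F = foldr (λ t acc → F t ⊗ acc) 𝟙 (upTo i)

factor : ℕ → Series
factor t = 𝟙 ⊕ (2 · (X^ (2 ^ t) ⊗ geom (2 ^ suc t)))

term : ℕ → Series
term i = (X^ (2 ^ i) ⊗ geom (2 ^ suc i)) ⊗ Π< i factor

gfPartial : ℕ → Series
gfPartial I = 𝟙 ⊕ Σ< I term

-- Both sides obey the semi-Pell recursion.
--
-- Compositions: every part other than 1 is even and the 1s form a single block of odd length,
-- so a composition counted by oc(n) contains a 1 exactly when n is odd. Halving all parts is
-- therefore a bijection from the compositions of 2k onto those of k. For odd n, unimodality
-- pushes the block of 1s to an end of the composition; removing a lone 1 at the front or at the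
-- back, or two 1s from a longer block, maps the compositions of n bijectively onto two copies of
-- those of n - 1 and one copy of those of n - 2.
--
-- Generating function: write T_I for the sum of term i over i < I and (D f)(x) = f(x²). As
-- factor 0 · D (term i) = term (i + 1), we get T_{I+1} = x/(1 - x²) + (1 + 2x/(1 - x²)) · D T_I.
-- Hence the even coefficients of 1 + T_{I+1} are those of 1 + T_I, and its coefficient of
-- x^{2m+1}, plus 1, is twice the sum of the first m + 1 coefficients of 1 + T_I: the recursion
-- satisfied by sp.

module Submission where

open import Defs
open import Data.Nat using (ℕ; _<_; _^_)
open import Data.Product using (_×_)
open import Relation.Binary.PropositionalEquality using (_≡_)

open import Data.List using (List; []; _∷_; _++_; [_]; _∷ʳ_; map; replicate; reverse; foldr; upTo; applyUpTo)
open import Data.List.Membership.Propositional using (_∈_; _∉_)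
open import Data.List.Membership.Propositional.Properties using (∈-map⁺; ∈-map⁻; ∈-++⁺ˡ; ∈-++⁺ʳ; ∈-++⁻)
open import Data.List.Properties
  using (map-∘; foldr-map; ++-identityʳ; ++-assoc; map-++; map-replicate; map-injective; length-map; length-++;
         reverse-++; reverse-involutive; unfold-reverse; ∷-injective; ∷-injectiveˡ; ∷-injectiveʳ; ∷ʳ-injectiveˡ)
open import Data.List.Relation.Unary.All as All using (All; []; _∷_)
open import Data.List.Relation.Unary.All.Properties as All using (All¬⇒¬Any)
import Data.List.Relation.Unary.AllPairs as AllPairs
open AllPairs using ([]; _∷_)
open import Data.List.Relation.Unary.Any using (Any; here; there)
import Data.List.Relation.Unary.Any.Properties as Any
open import Data.List.Relation.Unary.Linked as Linked using (Linked; []; [-]; _∷_)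
import Data.List.Relation.Unary.Linked.Properties as Linked
open import Data.List.Relation.Unary.Unique.Propositional using (Unique)
import Data.List.Relation.Unary.Unique.Propositional.Properties as Unique
open import Data.Nat using (zero; suc; _+_; _*_; _∸_; _≤_; z≤n; s≤s; z<s; _≟_; _<?_)
open import Data.List.Membership.DecPropositional _≟_ using (_∈?_)
open import Data.Nat.DivMod using (_/_; _%_; m/n<m; m*n%n≡0; m*n/n≡m; [m+kn]%n≡m%n)
open import Data.Nat.Divisibility
  using (_∣_; _∣?_; divides; 1∣_; ∣-refl; ∣1⇒≡1; ∣-trans; ∣m∣n⇒∣m+n; ∣m+n∣m⇒∣n; m∣m*n; *-monoʳ-∣; *-cancelˡ-∣)
open import Data.Nat.Induction using (<-rec)
open import Data.Nat.ListAction using (sum)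
open import Data.Nat.ListAction.Properties using (sum-++)
open import Data.Nat.Properties
open import Data.Nat.Tactic.RingSolver using (solve-∀)
open import Data.Product using (Σ; _,_)
open import Data.Sum using (_⊎_; inj₁; inj₂)
open import Function using (_∘_)
open import Function.Bundles using (_⇔_; mk⇔; Equivalence)
open import Function.Definitions using (Injective)
open import Relation.Nullary using (¬_; Dec; yes; no; contradiction)
open import Relation.Nullary.Decidable using (dec-true; dec-false)
open import Relation.Binary.PropositionalEquality
  using (_≢_; _≗_; refl; sym; trans; cong; cong₂; cong-app; subst; _→-setoid_; module ≡-Reasoning)
import Relation.Binary.Reasoning.Setoid as SetoidReasoning

-- The semi-Pell recursion

data Parity : ℕ → Set where
  even : ∀ m → Parity (2 * m)
  odd  : ∀ m → Parity (1 + 2 * m)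

parity : ∀ n → Parity n
parity zero = even 0
parity (suc n) with parity n
... | even m = odd m
... | odd m = subst Parity (*-suc 2 m) (even (suc m))

¬2∣1+2*m : ∀ m → ¬ 2 ∣ 1 + 2 * m
¬2∣1+2*m m 2∣1+2m with ∣1⇒≡1 (∣m+n∣m⇒∣n (subst (2 ∣_) (+-comm 1 (2 * m)) 2∣1+2m) (m∣m*n m))
... | ()

¬2∣3+2*k : ∀ k → ¬ 2 ∣ 3 + 2 * k
¬2∣3+2*k k = ¬2∣1+2*m (suc k) ∘ subst (2 ∣_) (cong suc (sym (*-suc 2 k)))

2∣2+2*k : ∀ k → 2 ∣ 2 + 2 * k
2∣2+2*k k = ∣m∣n⇒∣m+n ∣-refl (m∣m*n k)

spFuel-irrelevant : ∀ {f g} n → n < f → n < g → spFuel f n ≡ spFuel g n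
spFuel-irrelevant {suc f} {suc g} zero _ _ = refl
spFuel-irrelevant {suc f} {suc g} (suc zero) _ _ = refl
spFuel-irrelevant {suc f} {suc g} (suc (suc m)) (s≤s n<1+f) (s≤s n<1+g) with suc (suc m) % 2
... | zero  = spFuel-irrelevant _ (<-≤-trans half<n n<1+f) (<-≤-trans half<n n<1+g)
  where
  half<n : suc (suc m) / 2 < suc (suc m)
  half<n = m/n<m (suc (suc m)) 2 (s≤s (s≤s z≤n))
... | suc _ = cong₂ (λ a b → 2 * a + b)
  (spFuel-irrelevant (suc m) n<1+f n<1+g)
  (spFuel-irrelevant m (<-trans (n<1+n m) n<1+f) (<-trans (n<1+n m) n<1+g))

sp-unfold-even : ∀ m → suc (suc m) % 2 ≡ 0 → sp (suc (suc m)) ≡ sp (suc (suc m) / 2)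
sp-unfold-even m _ with suc (suc m) % 2
sp-unfold-even m refl | zero =
  spFuel-irrelevant _ (m/n<m (suc (suc m)) 2 (s≤s (s≤s z≤n))) ≤-refl

sp-unfold-odd : ∀ m → suc (suc m) % 2 ≡ 1 → sp (suc (suc m)) ≡ 2 * sp (suc m) + sp m
sp-unfold-odd m _ with suc (suc m) % 2
sp-unfold-odd m refl | suc zero = cong₂ (λ a b → 2 * a + b)
  (spFuel-irrelevant (suc m) (n<1+n _) ≤-refl)
  (spFuel-irrelevant m (<-trans (n<1+n m) (n<1+n _)) ≤-refl)

2+2*m≡[1+m]*2 : ∀ m → 2 + 2 * m ≡ suc m * 2
2+2*m≡[1+m]*2 m = trans (sym (*-suc 2 m)) (*-comm 2 (suc m))

sp-double : ∀ m → sp (2 * m) ≡ sp m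
sp-double zero = refl
sp-double (suc m) rewrite *-suc 2 m = begin
  sp (2 + 2 * m)        ≡⟨ sp-unfold-even (2 * m) (trans (cong (_% 2) (2+2*m≡[1+m]*2 m)) (m*n%n≡0 (suc m) 2)) ⟩
  sp ((2 + 2 * m) / 2)  ≡⟨ cong sp (trans (cong (_/ 2) (2+2*m≡[1+m]*2 m)) (m*n/n≡m (suc m) 2)) ⟩
  sp (suc m)            ∎
  where open ≡-Reasoning

sp-odd : ∀ k → sp (3 + 2 * k) ≡ 2 * sp (2 + 2 * k) + sp (1 + 2 * k)
sp-odd k = sp-unfold-odd (1 + 2 * k)
  (trans (cong (λ n → suc n % 2) (2+2*m≡[1+m]*2 k)) ([m+kn]%n≡m%n 1 (suc k) 2))

-- Formal power series

shift : Series → Series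
shift f n = f (suc n)

𝟘 : Series
𝟘 _ = 0

module ≗-Reasoning = SetoidReasoning (ℕ →-setoid ℕ)

applyUpTo≡map-upTo : ∀ {A : Set} (g : ℕ → A) n → applyUpTo g n ≡ map g (upTo n)
applyUpTo≡map-upTo g zero = refl
applyUpTo≡map-upTo g (suc n) = cong (g 0 ∷_) (begin
  applyUpTo (g ∘ suc) n     ≡⟨ applyUpTo≡map-upTo (g ∘ suc) n ⟩
  map (g ∘ suc) (upTo n)    ≡⟨ map-∘ (upTo n) ⟩
  map g (map suc (upTo n))  ≡⟨ cong (map g) (applyUpTo≡map-upTo suc n) ⟨
  map g (applyUpTo suc n)   ∎)
  where open ≡-Reasoning

⊗-coeff-zero : ∀ f g → (f ⊗ g) 0 ≡ f 0 * g 0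
⊗-coeff-zero f g = +-identityʳ _

shift-⊗ : ∀ f g → shift (f ⊗ g) ≗ (f 0 · shift g) ⊕ (shift f ⊗ g)
shift-⊗ f g n = cong (λ ks → f 0 * g (suc n) + sum ks) (begin
  map summand (applyUpTo suc (suc n))   ≡⟨ cong (map summand) (applyUpTo≡map-upTo suc (suc n)) ⟩
  map summand (map suc (upTo (suc n)))  ≡⟨ map-∘ (upTo (suc n)) ⟨
  map (summand ∘ suc) (upTo (suc n))    ∎)
  where
  open ≡-Reasoning
  summand : ℕ → ℕ
  summand k = f k * g (suc n ∸ k)

⊗-cong : ∀ {f f′ g g′} → f ≗ f′ → g ≗ g′ → f ⊗ g ≗ f′ ⊗ g′
⊗-cong p q zero = cong₂ (λ a b → a * b + 0) (p 0) (q 0)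
⊗-cong {f} {f′} {g} {g′} p q (suc n) = begin
  (f ⊗ g) (suc n)                           ≡⟨ shift-⊗ f g n ⟩
  f 0 * g (suc n) + (shift f ⊗ g) n         ≡⟨ cong₂ _+_ (cong₂ _*_ (p 0) (q (suc n))) (⊗-cong (p ∘ suc) q n) ⟩
  f′ 0 * g′ (suc n) + (shift f′ ⊗ g′) n     ≡⟨ shift-⊗ f′ g′ n ⟨
  (f′ ⊗ g′) (suc n)                         ∎
  where open ≡-Reasoning

⊗-congˡ : ∀ {f f′} g → f ≗ f′ → f ⊗ g ≗ f′ ⊗ g
⊗-congˡ g p = ⊗-cong {g = g} p (λ _ → refl)

⊗-congʳ : ∀ f {g g′} → g ≗ g′ → f ⊗ g ≗ f ⊗ g′
⊗-congʳ f q = ⊗-cong {f = f} (λ _ → refl) q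

⊕-cong : ∀ {f f′ g g′} → f ≗ f′ → g ≗ g′ → f ⊕ g ≗ f′ ⊕ g′
⊕-cong p q n = cong₂ _+_ (p n) (q n)

⊕-congʳ : ∀ f {g g′} → g ≗ g′ → f ⊕ g ≗ f ⊕ g′
⊕-congʳ f q n = cong (f n +_) (q n)

·-cong : ∀ c {f g} → f ≗ g → c · f ≗ c · g
·-cong c p n = cong (c *_) (p n)

⊗-zeroˡ : ∀ g → 𝟘 ⊗ g ≗ 𝟘
⊗-zeroˡ g zero = refl
⊗-zeroˡ g (suc n) = trans (shift-⊗ 𝟘 g n) (⊗-zeroˡ g n)

⊗-identityˡ : ∀ g → 𝟙 ⊗ g ≗ g
⊗-identityˡ g zero = trans (+-identityʳ _) (*-identityˡ _)
⊗-identityˡ g (suc n) = begin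
  (𝟙 ⊗ g) (suc n)             ≡⟨ shift-⊗ 𝟙 g n ⟩
  1 * g (suc n) + (𝟘 ⊗ g) n   ≡⟨ cong (1 * g (suc n) +_) (⊗-zeroˡ g n) ⟩
  1 * g (suc n) + 0           ≡⟨ trans (+-identityʳ _) (*-identityˡ _) ⟩
  g (suc n)                   ∎
  where open ≡-Reasoning

[a+b]c+[x+y]≡[ac+x]+[bc+y] : ∀ a b c x y → (a + b) * c + (x + y) ≡ (a * c + x) + (b * c + y)
[a+b]c+[x+y]≡[ac+x]+[bc+y] = solve-∀

c*a*b+c*x≡c*[a*b+x] : ∀ c a b x → c * a * b + c * x ≡ c * (a * b + x)
c*a*b+c*x≡c*[a*b+x] = solve-∀

⊗-distribʳ-⊕ : ∀ f g h → (f ⊕ g) ⊗ h ≗ (f ⊗ h) ⊕ (g ⊗ h)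
⊗-distribʳ-⊕ f g h zero = [a+b]c+[x+y]≡[ac+x]+[bc+y] (f 0) (g 0) (h 0) 0 0
⊗-distribʳ-⊕ f g h (suc n) = begin
  ((f ⊕ g) ⊗ h) (suc n)
    ≡⟨ shift-⊗ (f ⊕ g) h n ⟩
  (f 0 + g 0) * h (suc n) + ((shift f ⊕ shift g) ⊗ h) n
    ≡⟨ cong ((f 0 + g 0) * h (suc n) +_) (⊗-distribʳ-⊕ (shift f) (shift g) h n) ⟩
  (f 0 + g 0) * h (suc n) + ((shift f ⊗ h) n + (shift g ⊗ h) n)
    ≡⟨ [a+b]c+[x+y]≡[ac+x]+[bc+y] (f 0) (g 0) (h (suc n)) _ _ ⟩
  (f 0 * h (suc n) + (shift f ⊗ h) n) + (g 0 * h (suc n) + (shift g ⊗ h) n)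
    ≡⟨ cong₂ _+_ (shift-⊗ f h n) (shift-⊗ g h n) ⟨
  ((f ⊗ h) ⊕ (g ⊗ h)) (suc n)  ∎
  where open ≡-Reasoning

·-⊗-assoc : ∀ c f g → (c · f) ⊗ g ≗ c · (f ⊗ g)
·-⊗-assoc c f g zero = trans (cong (c * f 0 * g 0 +_) (sym (*-zeroʳ c))) (c*a*b+c*x≡c*[a*b+x] c (f 0) (g 0) 0)
·-⊗-assoc c f g (suc n) = begin
  ((c · f) ⊗ g) (suc n)                          ≡⟨ shift-⊗ (c · f) g n ⟩
  c * f 0 * g (suc n) + ((c · shift f) ⊗ g) n     ≡⟨ cong (c * f 0 * g (suc n) +_) (·-⊗-assoc c (shift f) g n) ⟩
  c * f 0 * g (suc n) + c * (shift f ⊗ g) n       ≡⟨ c*a*b+c*x≡c*[a*b+x] c (f 0) (g (suc n)) _ ⟩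
  c * (f 0 * g (suc n) + (shift f ⊗ g) n)         ≡⟨ cong (c *_) (shift-⊗ f g n) ⟨
  c * (f ⊗ g) (suc n)                            ∎
  where open ≡-Reasoning

shift-⊗ʳ : ∀ f g → shift (f ⊗ g) ≗ (f ⊗ shift g) ⊕ (g 0 · shift f)
shift-⊗ʳ f g zero = begin
  f 0 * g 1 + (f 1 * g 0 + 0)    ≡⟨ cong (f 0 * g 1 +_) (trans (+-identityʳ _) (*-comm (f 1) (g 0))) ⟩
  f 0 * g 1 + g 0 * f 1          ≡⟨ cong (_+ g 0 * f 1) (+-identityʳ _) ⟨
  (f 0 * g 1 + 0) + g 0 * f 1    ∎
  where open ≡-Reasoning
shift-⊗ʳ f g (suc n) = begin
  (f ⊗ g) (2 + n)                                                      ≡⟨ shift-⊗ f g (suc n) ⟩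
  f 0 * g (2 + n) + (shift f ⊗ g) (suc n)                              ≡⟨ cong (f 0 * g (2 + n) +_) (shift-⊗ʳ (shift f) g n) ⟩
  f 0 * g (2 + n) + ((shift f ⊗ shift g) n + g 0 * f (2 + n))          ≡⟨ +-assoc (f 0 * g (2 + n)) _ _ ⟨
  (f 0 * g (2 + n) + (shift f ⊗ shift g) n) + g 0 * f (2 + n)          ≡⟨ cong (_+ g 0 * f (2 + n)) (shift-⊗ f (shift g) n) ⟨
  (f ⊗ shift g) (suc n) + g 0 * f (2 + n)                              ∎
  where open ≡-Reasoning

⊗-comm : ∀ f g → f ⊗ g ≗ g ⊗ f
⊗-comm f g zero = cong (_+ 0) (*-comm (f 0) (g 0))
⊗-comm f g (suc n) = begin
  (f ⊗ g) (suc n)                       ≡⟨ shift-⊗ f g n ⟩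
  f 0 * g (suc n) + (shift f ⊗ g) n     ≡⟨ cong (f 0 * g (suc n) +_) (⊗-comm (shift f) g n) ⟩
  f 0 * g (suc n) + (g ⊗ shift f) n     ≡⟨ +-comm (f 0 * g (suc n)) _ ⟩
  (g ⊗ shift f) n + f 0 * g (suc n)     ≡⟨ shift-⊗ʳ g f n ⟨
  (g ⊗ f) (suc n)                       ∎
  where open ≡-Reasoning

⊗-assoc : ∀ f g h → (f ⊗ g) ⊗ h ≗ f ⊗ (g ⊗ h)
⊗-assoc f g h zero = begin
  ((f ⊗ g) ⊗ h) 0      ≡⟨ ⊗-coeff-zero (f ⊗ g) h ⟩
  (f ⊗ g) 0 * h 0      ≡⟨ cong (_* h 0) (⊗-coeff-zero f g) ⟩
  f 0 * g 0 * h 0      ≡⟨ *-assoc (f 0) (g 0) (h 0) ⟩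
  f 0 * (g 0 * h 0)    ≡⟨ cong (f 0 *_) (⊗-coeff-zero g h) ⟨
  f 0 * (g ⊗ h) 0      ≡⟨ ⊗-coeff-zero f (g ⊗ h) ⟨
  (f ⊗ (g ⊗ h)) 0      ∎
  where open ≡-Reasoning
⊗-assoc f g h (suc n) = begin
  ((f ⊗ g) ⊗ h) (suc n)
    ≡⟨ shift-⊗ (f ⊗ g) h n ⟩
  (f ⊗ g) 0 * h (suc n) + (shift (f ⊗ g) ⊗ h) n
    ≡⟨ cong₂ _+_ (cong (_* h (suc n)) (⊗-coeff-zero f g)) (⊗-congˡ h (shift-⊗ f g) n) ⟩
  f 0 * g 0 * h (suc n) + (((f 0 · shift g) ⊕ (shift f ⊗ g)) ⊗ h) n
    ≡⟨ cong (f 0 * g 0 * h (suc n) +_) (⊗-distribʳ-⊕ (f 0 · shift g) (shift f ⊗ g) h n) ⟩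
  f 0 * g 0 * h (suc n) + (((f 0 · shift g) ⊗ h) n + ((shift f ⊗ g) ⊗ h) n)
    ≡⟨ cong (f 0 * g 0 * h (suc n) +_) (cong₂ _+_ (·-⊗-assoc (f 0) (shift g) h n) (⊗-assoc (shift f) g h n)) ⟩
  f 0 * g 0 * h (suc n) + (f 0 * (shift g ⊗ h) n + (shift f ⊗ (g ⊗ h)) n)
    ≡⟨ a*b*c+[a*x+y]≡a*[b*c+x]+y (f 0) (g 0) (h (suc n)) _ _ ⟩
  f 0 * (g 0 * h (suc n) + (shift g ⊗ h) n) + (shift f ⊗ (g ⊗ h)) n
    ≡⟨ cong (λ x → f 0 * x + (shift f ⊗ (g ⊗ h)) n) (shift-⊗ g h n) ⟨
  f 0 * (g ⊗ h) (suc n) + (shift f ⊗ (g ⊗ h)) n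
    ≡⟨ shift-⊗ f (g ⊗ h) n ⟨
  (f ⊗ (g ⊗ h)) (suc n)  ∎
  where
  open ≡-Reasoning
  a*b*c+[a*x+y]≡a*[b*c+x]+y : ∀ a b c x y → a * b * c + (a * x + y) ≡ a * (b * c + x) + y
  a*b*c+[a*x+y]≡a*[b*c+x]+y = solve-∀

⊗-zeroʳ : ∀ f → f ⊗ 𝟘 ≗ 𝟘
⊗-zeroʳ f n = trans (⊗-comm f 𝟘 n) (⊗-zeroˡ f n)

⊗-identityʳ : ∀ f → f ⊗ 𝟙 ≗ f
⊗-identityʳ f n = trans (⊗-comm f 𝟙 n) (⊗-identityˡ f n)

⊗-distribˡ-⊕ : ∀ f g h → f ⊗ (g ⊕ h) ≗ (f ⊗ g) ⊕ (f ⊗ h)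
⊗-distribˡ-⊕ f g h n = begin
  (f ⊗ (g ⊕ h)) n            ≡⟨ ⊗-comm f (g ⊕ h) n ⟩
  ((g ⊕ h) ⊗ f) n            ≡⟨ ⊗-distribʳ-⊕ g h f n ⟩
  (g ⊗ f) n + (h ⊗ f) n      ≡⟨ cong₂ _+_ (⊗-comm g f n) (⊗-comm h f n) ⟩
  (f ⊗ g) n + (f ⊗ h) n      ∎
  where open ≡-Reasoning

⊗-leftComm : ∀ f g h → f ⊗ (g ⊗ h) ≗ g ⊗ (f ⊗ h)
⊗-leftComm f g h = begin
  f ⊗ (g ⊗ h)   ≈⟨ ⊗-assoc f g h ⟨
  (f ⊗ g) ⊗ h   ≈⟨ ⊗-congˡ h (⊗-comm f g) ⟩
  (g ⊗ f) ⊗ h   ≈⟨ ⊗-assoc g f h ⟩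
  g ⊗ (f ⊗ h)   ∎
  where open ≗-Reasoning

-- dilate f (x) = f (x²)
dilate : Series → Series
dilate f zero = f 0
dilate f (suc zero) = 0
dilate f (suc (suc n)) = dilate (shift f) n

dilate-even : ∀ f m → dilate f (2 * m) ≡ f m
dilate-even f zero = refl
dilate-even f (suc m) rewrite *-suc 2 m = dilate-even (shift f) m

dilate-odd : ∀ f m → dilate f (1 + 2 * m) ≡ 0
dilate-odd f zero = refl
dilate-odd f (suc m) = trans (cong (dilate f ∘ suc) (*-suc 2 m)) (dilate-odd (shift f) m)

dilate-cong : ∀ {f g} → f ≗ g → dilate f ≗ dilate g
dilate-cong p zero = p 0
dilate-cong p (suc zero) = refl
dilate-cong p (suc (suc n)) = dilate-cong (p ∘ suc) n

dilate-𝟘 : dilate 𝟘 ≗ 𝟘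
dilate-𝟘 zero = refl
dilate-𝟘 (suc zero) = refl
dilate-𝟘 (suc (suc n)) = dilate-𝟘 n

dilate-𝟙 : dilate 𝟙 ≗ 𝟙
dilate-𝟙 zero = refl
dilate-𝟙 (suc zero) = refl
dilate-𝟙 (suc (suc n)) = dilate-𝟘 n

dilate-⊕ : ∀ f g → dilate (f ⊕ g) ≗ dilate f ⊕ dilate g
dilate-⊕ f g zero = refl
dilate-⊕ f g (suc zero) = refl
dilate-⊕ f g (suc (suc n)) = dilate-⊕ (shift f) (shift g) n

dilate-· : ∀ c f → dilate (c · f) ≗ c · dilate f
dilate-· c f zero = refl
dilate-· c f (suc zero) = sym (*-zeroʳ c)
dilate-· c f (suc (suc n)) = dilate-· c (shift f) n

dilate-⊗ : ∀ f g → dilate (f ⊗ g) ≗ dilate f ⊗ dilate g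
dilate-⊗ f g zero = refl
dilate-⊗ f g (suc zero) = sym (cong (_+ 0) (*-zeroʳ (f 0)))
dilate-⊗ f g (suc (suc n)) = begin
  dilate (shift (f ⊗ g)) n
    ≡⟨ dilate-cong (shift-⊗ f g) n ⟩
  dilate ((f 0 · shift g) ⊕ (shift f ⊗ g)) n
    ≡⟨ dilate-⊕ (f 0 · shift g) (shift f ⊗ g) n ⟩
  dilate (f 0 · shift g) n + dilate (shift f ⊗ g) n
    ≡⟨ cong₂ _+_ (dilate-· (f 0) (shift g) n) (dilate-⊗ (shift f) g n) ⟩
  f 0 * dilate (shift g) n + (dilate (shift f) ⊗ dilate g) n
    ≡⟨ cong (f 0 * dilate (shift g) n +_) (shift-⊗ (shift (dilate f)) (dilate g) n) ⟨
  f 0 * dilate g (2 + n) + (shift (dilate f) ⊗ dilate g) (suc n)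
    ≡⟨ shift-⊗ (dilate f) (dilate g) (suc n) ⟨
  (dilate f ⊗ dilate g) (2 + n)  ∎
  where open ≡-Reasoning

dilate-X^ : ∀ k → dilate (X^ k) ≗ X^ (2 * k)
dilate-X^ zero zero = refl
dilate-X^ (suc k) zero = refl
dilate-X^ zero (suc zero) = refl
dilate-X^ (suc k) (suc zero) = sym (cong (λ j → X^ j 1) (*-suc 2 k))
dilate-X^ zero (suc (suc n)) = dilate-𝟘 n
dilate-X^ (suc k) (suc (suc n)) = trans (dilate-X^ k n) (sym (cong (λ j → X^ j (2 + n)) (*-suc 2 k)))

geom-dvd : ∀ m n → m ∣ n → geom m n ≡ 1
geom-dvd m n m∣n rewrite dec-true (m ∣? n) m∣n = refl

geom-¬dvd : ∀ m n → ¬ m ∣ n → geom m n ≡ 0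
geom-¬dvd m n m∤n rewrite dec-false (m ∣? n) m∤n = refl

geom-1 : ∀ n → geom 1 n ≡ 1
geom-1 n = geom-dvd 1 n (1∣ n)

dilate-geom : ∀ m → dilate (geom m) ≗ geom (2 * m)
dilate-geom m n with parity n
... | even j = trans (dilate-even (geom m) j) (geom-double (m ∣? j))
  where
  geom-double : Dec (m ∣ j) → geom m j ≡ geom (2 * m) (2 * j)
  geom-double (yes m∣j) = trans (geom-dvd m j m∣j) (sym (geom-dvd _ _ (*-monoʳ-∣ 2 m∣j)))
  geom-double (no m∤j) = trans (geom-¬dvd m j m∤j) (sym (geom-¬dvd _ _ (m∤j ∘ *-cancelˡ-∣ 2)))
... | odd j = trans (dilate-odd (geom m) j) (sym (geom-¬dvd _ _ (¬2∣1+2*m j ∘ ∣-trans (m∣m*n m))))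

foldr-upTo-suc : ∀ {A : Set} (h : ℕ → A → A) z n →
  foldr h z (upTo (suc n)) ≡ h 0 (foldr (h ∘ suc) z (upTo n))
foldr-upTo-suc h z n = cong (h 0) (trans (cong (foldr h z) (applyUpTo≡map-upTo suc n)) (foldr-map h suc z (upTo n)))

Σ<-suc : ∀ I F → Σ< (suc I) F ≡ F 0 ⊕ Σ< I (F ∘ suc)
Σ<-suc I F = foldr-upTo-suc (λ t acc → F t ⊕ acc) 𝟘 I

Π<-suc : ∀ I F → Π< (suc I) F ≡ F 0 ⊗ Π< I (F ∘ suc)
Π<-suc I F = foldr-upTo-suc (λ t acc → F t ⊗ acc) 𝟙 I

Σ<-cong : ∀ I {F G} → (∀ t → F t ≗ G t) → Σ< I F ≗ Σ< I G
Σ<-cong zero p = λ _ → refl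
Σ<-cong (suc I) {F} {G} p = begin
  Σ< (suc I) F                ≈⟨ cong-app (Σ<-suc I F) ⟩
  F 0 ⊕ Σ< I (F ∘ suc)        ≈⟨ ⊕-cong (p 0) (Σ<-cong I (p ∘ suc)) ⟩
  G 0 ⊕ Σ< I (G ∘ suc)        ≈⟨ cong-app (Σ<-suc I G) ⟨
  Σ< (suc I) G                ∎
  where open ≗-Reasoning

Π<-cong : ∀ I {F G} → (∀ t → F t ≗ G t) → Π< I F ≗ Π< I G
Π<-cong zero p = λ _ → refl
Π<-cong (suc I) {F} {G} p = begin
  Π< (suc I) F                ≈⟨ cong-app (Π<-suc I F) ⟩
  F 0 ⊗ Π< I (F ∘ suc)        ≈⟨ ⊗-cong (p 0) (Π<-cong I (p ∘ suc)) ⟩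
  G 0 ⊗ Π< I (G ∘ suc)        ≈⟨ cong-app (Π<-suc I G) ⟨
  Π< (suc I) G                ∎
  where open ≗-Reasoning

⊗-distribˡ-Σ< : ∀ I c F → c ⊗ Σ< I F ≗ Σ< I (λ t → c ⊗ F t)
⊗-distribˡ-Σ< zero c F = ⊗-zeroʳ c
⊗-distribˡ-Σ< (suc I) c F = begin
  c ⊗ Σ< (suc I) F                           ≈⟨ ⊗-congʳ c (cong-app (Σ<-suc I F)) ⟩
  c ⊗ (F 0 ⊕ Σ< I (F ∘ suc))                 ≈⟨ ⊗-distribˡ-⊕ c (F 0) _ ⟩
  (c ⊗ F 0) ⊕ (c ⊗ Σ< I (F ∘ suc))           ≈⟨ ⊕-congʳ (c ⊗ F 0) (⊗-distribˡ-Σ< I c (F ∘ suc)) ⟩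
  (c ⊗ F 0) ⊕ Σ< I (λ t → c ⊗ F (suc t))     ≈⟨ cong-app (Σ<-suc I (λ t → c ⊗ F t)) ⟨
  Σ< (suc I) (λ t → c ⊗ F t)                 ∎
  where open ≗-Reasoning

dilate-Σ< : ∀ I F → dilate (Σ< I F) ≗ Σ< I (dilate ∘ F)
dilate-Σ< zero F = dilate-𝟘
dilate-Σ< (suc I) F = begin
  dilate (Σ< (suc I) F)                      ≈⟨ dilate-cong (cong-app (Σ<-suc I F)) ⟩
  dilate (F 0 ⊕ Σ< I (F ∘ suc))              ≈⟨ dilate-⊕ (F 0) _ ⟩
  dilate (F 0) ⊕ dilate (Σ< I (F ∘ suc))     ≈⟨ ⊕-congʳ (dilate (F 0)) (dilate-Σ< I (F ∘ suc)) ⟩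
  dilate (F 0) ⊕ Σ< I (dilate ∘ F ∘ suc)     ≈⟨ cong-app (Σ<-suc I (dilate ∘ F)) ⟨
  Σ< (suc I) (dilate ∘ F)                    ∎
  where open ≗-Reasoning

dilate-Π< : ∀ I F → dilate (Π< I F) ≗ Π< I (dilate ∘ F)
dilate-Π< zero F = dilate-𝟙
dilate-Π< (suc I) F = begin
  dilate (Π< (suc I) F)                      ≈⟨ dilate-cong (cong-app (Π<-suc I F)) ⟩
  dilate (F 0 ⊗ Π< I (F ∘ suc))              ≈⟨ dilate-⊗ (F 0) _ ⟩
  dilate (F 0) ⊗ dilate (Π< I (F ∘ suc))     ≈⟨ ⊗-congʳ (dilate (F 0)) (dilate-Π< I (F ∘ suc)) ⟩
  dilate (F 0) ⊗ Π< I (dilate ∘ F ∘ suc)     ≈⟨ cong-app (Π<-suc I (dilate ∘ F)) ⟨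
  Π< (suc I) (dilate ∘ F)                    ∎
  where open ≗-Reasoning

-- The partial sums of the generating function

-- atom i = x^(2^i) / (1 - x^(2^(i+1))), the series of the numbers of 2-adic valuation i
atom : ℕ → Series
atom i = X^ (2 ^ i) ⊗ geom (2 ^ suc i)

dilate-atom : ∀ i → dilate (atom i) ≗ atom (suc i)
dilate-atom i = begin
  dilate (atom i)                                   ≈⟨ dilate-⊗ (X^ (2 ^ i)) (geom (2 ^ suc i)) ⟩
  dilate (X^ (2 ^ i)) ⊗ dilate (geom (2 ^ suc i))   ≈⟨ ⊗-cong (dilate-X^ (2 ^ i)) (dilate-geom (2 ^ suc i)) ⟩
  atom (suc i)                                      ∎
  where open ≗-Reasoning

dilate-factor : ∀ t → dilate (factor t) ≗ factor (suc t)
dilate-factor t = begin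
  dilate (𝟙 ⊕ (2 · atom t))             ≈⟨ dilate-⊕ 𝟙 (2 · atom t) ⟩
  dilate 𝟙 ⊕ dilate (2 · atom t)        ≈⟨ ⊕-cong dilate-𝟙 (dilate-· 2 (atom t)) ⟩
  𝟙 ⊕ (2 · dilate (atom t))             ≈⟨ ⊕-congʳ 𝟙 (·-cong 2 (dilate-atom t)) ⟩
  𝟙 ⊕ (2 · atom (suc t))                ∎
  where open ≗-Reasoning

term-suc : ∀ i → term (suc i) ≗ factor 0 ⊗ dilate (term i)
term-suc i = begin
  atom (suc i) ⊗ Π< (suc i) factor
    ≈⟨ ⊗-congʳ (atom (suc i)) (cong-app (Π<-suc i factor)) ⟩
  atom (suc i) ⊗ (factor 0 ⊗ Π< i (factor ∘ suc))
    ≈⟨ ⊗-leftComm (atom (suc i)) (factor 0) _ ⟩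
  factor 0 ⊗ (atom (suc i) ⊗ Π< i (factor ∘ suc))
    ≈⟨ ⊗-congʳ (factor 0) (⊗-cong (dilate-atom i) (Π<-cong i dilate-factor)) ⟨
  factor 0 ⊗ (dilate (atom i) ⊗ Π< i (dilate ∘ factor))
    ≈⟨ ⊗-congʳ (factor 0) (⊗-congʳ (dilate (atom i)) (dilate-Π< i factor)) ⟨
  factor 0 ⊗ (dilate (atom i) ⊗ dilate (Π< i factor))
    ≈⟨ ⊗-congʳ (factor 0) (dilate-⊗ (atom i) (Π< i factor)) ⟨
  factor 0 ⊗ dilate (term i)  ∎
  where open ≗-Reasoning

factor-0-⊗-dilate : ∀ f → factor 0 ⊗ dilate f ≗ dilate f ⊕ (2 · (X^ 1 ⊗ dilate (geom 1 ⊗ f)))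
factor-0-⊗-dilate f = begin
  (𝟙 ⊕ (2 · atom 0)) ⊗ dilate f
    ≈⟨ ⊗-distribʳ-⊕ 𝟙 (2 · atom 0) (dilate f) ⟩
  (𝟙 ⊗ dilate f) ⊕ ((2 · atom 0) ⊗ dilate f)
    ≈⟨ ⊕-cong (⊗-identityˡ (dilate f)) (·-⊗-assoc 2 (atom 0) (dilate f)) ⟩
  dilate f ⊕ (2 · ((X^ 1 ⊗ geom 2) ⊗ dilate f))
    ≈⟨ ⊕-congʳ (dilate f) (·-cong 2 (⊗-assoc (X^ 1) (geom 2) (dilate f))) ⟩
  dilate f ⊕ (2 · (X^ 1 ⊗ (geom 2 ⊗ dilate f)))
    ≈⟨ ⊕-congʳ (dilate f) (·-cong 2 (⊗-congʳ (X^ 1) (⊗-congˡ (dilate f) (dilate-geom 1)))) ⟨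
  dilate f ⊕ (2 · (X^ 1 ⊗ (dilate (geom 1) ⊗ dilate f)))
    ≈⟨ ⊕-congʳ (dilate f) (·-cong 2 (⊗-congʳ (X^ 1) (dilate-⊗ (geom 1) f))) ⟨
  dilate f ⊕ (2 · (X^ 1 ⊗ dilate (geom 1 ⊗ f)))  ∎
  where open ≗-Reasoning

Σ<-term-suc : ∀ I → Σ< (suc I) term ≗ atom 0 ⊕ (dilate (Σ< I term) ⊕ (2 · (X^ 1 ⊗ dilate (geom 1 ⊗ Σ< I term))))
Σ<-term-suc I = begin
  Σ< (suc I) term
    ≈⟨ cong-app (Σ<-suc I term) ⟩
  term 0 ⊕ Σ< I (term ∘ suc)
    ≈⟨ ⊕-cong (⊗-identityʳ (atom 0)) (Σ<-cong I term-suc) ⟩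
  atom 0 ⊕ Σ< I (λ i → factor 0 ⊗ dilate (term i))
    ≈⟨ ⊕-congʳ (atom 0) (⊗-distribˡ-Σ< I (factor 0) (dilate ∘ term)) ⟨
  atom 0 ⊕ (factor 0 ⊗ Σ< I (dilate ∘ term))
    ≈⟨ ⊕-congʳ (atom 0) (⊗-congʳ (factor 0) (dilate-Σ< I term)) ⟨
  atom 0 ⊕ (factor 0 ⊗ dilate (Σ< I term))
    ≈⟨ ⊕-congʳ (atom 0) (factor-0-⊗-dilate (Σ< I term)) ⟩
  atom 0 ⊕ (dilate (Σ< I term) ⊕ (2 · (X^ 1 ⊗ dilate (geom 1 ⊗ Σ< I term))))  ∎
  where open ≗-Reasoning

X^1⊗-suc : ∀ h n → (X^ 1 ⊗ h) (suc n) ≡ h n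
X^1⊗-suc h n = trans (shift-⊗ (X^ 1) h n) (trans (⊗-congˡ h shift-X^1 n) (⊗-identityˡ h n))
  where
  shift-X^1 : shift (X^ 1) ≗ 𝟙
  shift-X^1 zero = refl
  shift-X^1 (suc n) = refl

X^1⊗dilate-even : ∀ h m → (X^ 1 ⊗ dilate h) (2 * m) ≡ 0
X^1⊗dilate-even h zero = refl
X^1⊗dilate-even h (suc m) = begin
  (X^ 1 ⊗ dilate h) (2 * suc m)      ≡⟨ cong (X^ 1 ⊗ dilate h) (*-suc 2 m) ⟩
  (X^ 1 ⊗ dilate h) (2 + 2 * m)      ≡⟨ X^1⊗-suc (dilate h) (1 + 2 * m) ⟩
  dilate h (1 + 2 * m)               ≡⟨ dilate-odd h m ⟩
  0                                  ∎
  where open ≡-Reasoning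

X^1⊗dilate-odd : ∀ h m → (X^ 1 ⊗ dilate h) (1 + 2 * m) ≡ h m
X^1⊗dilate-odd h m = trans (X^1⊗-suc (dilate h) (2 * m)) (dilate-even h m)

atom-0≗X^1⊗dilate-geom-1 : atom 0 ≗ X^ 1 ⊗ dilate (geom 1)
atom-0≗X^1⊗dilate-geom-1 n = sym (⊗-congʳ (X^ 1) (dilate-geom 1) n)

prefix-sum-zero : ∀ f → (geom 1 ⊗ f) 0 ≡ f 0
prefix-sum-zero f = trans (⊗-coeff-zero (geom 1) f) (trans (cong (_* f 0) (geom-1 0)) (*-identityˡ (f 0)))

prefix-sum-suc : ∀ f m → (geom 1 ⊗ f) (suc m) ≡ f (suc m) + (geom 1 ⊗ f) m
prefix-sum-suc f m = trans (shift-⊗ (geom 1) f m)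
  (cong₂ _+_ (trans (cong (_* f (suc m)) (geom-1 0)) (*-identityˡ _)) (⊗-congˡ f shift-geom-1 m))
  where
  shift-geom-1 : shift (geom 1) ≗ geom 1
  shift-geom-1 n = trans (geom-1 (suc n)) (sym (geom-1 n))

prefix-sum-cong : ∀ {f g} m → (∀ j → j ≤ m → f j ≡ g j) → (geom 1 ⊗ f) m ≡ (geom 1 ⊗ g) m
prefix-sum-cong {f} {g} zero f≡g = trans (prefix-sum-zero f) (trans (f≡g 0 z≤n) (sym (prefix-sum-zero g)))
prefix-sum-cong {f} {g} (suc m) f≡g = begin
  (geom 1 ⊗ f) (suc m)              ≡⟨ prefix-sum-suc f m ⟩
  f (suc m) + (geom 1 ⊗ f) m        ≡⟨ cong₂ _+_ (f≡g (suc m) ≤-refl) (prefix-sum-cong m (λ j j≤m → f≡g j (m≤n⇒m≤1+n j≤m))) ⟩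
  g (suc m) + (geom 1 ⊗ g) m        ≡⟨ prefix-sum-suc g m ⟨
  (geom 1 ⊗ g) (suc m)              ∎
  where open ≡-Reasoning

sp-odd-prefix-sum : ∀ m → 1 + sp (1 + 2 * m) ≡ 2 * (geom 1 ⊗ sp) m
sp-odd-prefix-sum zero = cong (2 *_) (sym (prefix-sum-zero sp))
sp-odd-prefix-sum (suc m) = begin
  1 + sp (1 + 2 * suc m)                   ≡⟨ cong (λ n → 1 + sp (suc n)) (*-suc 2 m) ⟩
  1 + sp (3 + 2 * m)                       ≡⟨ cong (1 +_) (sp-odd m) ⟩
  1 + (2 * sp (2 + 2 * m) + sp (1 + 2 * m)) ≡⟨ +-suc (2 * sp (2 + 2 * m)) _ ⟨
  2 * sp (2 + 2 * m) + (1 + sp (1 + 2 * m)) ≡⟨ cong₂ (λ a b → 2 * a + b) (trans (cong sp (sym (*-suc 2 m))) (sp-double (suc m))) (sp-odd-prefix-sum m) ⟩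
  2 * sp (suc m) + 2 * (geom 1 ⊗ sp) m      ≡⟨ *-distribˡ-+ 2 (sp (suc m)) _ ⟨
  2 * (sp (suc m) + (geom 1 ⊗ sp) m)        ≡⟨ cong (2 *_) (prefix-sum-suc sp m) ⟨
  2 * (geom 1 ⊗ sp) (suc m)                 ∎
  where open ≡-Reasoning

gfPartial-even : ∀ I m → gfPartial (suc I) (2 * m) ≡ gfPartial I m
gfPartial-even I m = begin
  𝟙 (2 * m) + Σ< (suc I) term (2 * m)
    ≡⟨ cong₂ _+_ 𝟙-double (Σ<-term-suc I (2 * m)) ⟩
  𝟙 m + (atom 0 (2 * m) + (dilate (Σ< I term) (2 * m) + 2 * (X^ 1 ⊗ dilate (geom 1 ⊗ Σ< I term)) (2 * m)))
    ≡⟨ cong (𝟙 m +_) (cong₂ _+_ atom-0-even (cong₂ _+_ (dilate-even (Σ< I term) m) (cong (2 *_) (X^1⊗dilate-even _ m)))) ⟩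
  𝟙 m + (Σ< I term m + 0)
    ≡⟨ cong (𝟙 m +_) (+-identityʳ _) ⟩
  𝟙 m + Σ< I term m  ∎
  where
  open ≡-Reasoning
  𝟙-double : 𝟙 (2 * m) ≡ 𝟙 m
  𝟙-double = trans (sym (dilate-𝟙 (2 * m))) (dilate-even 𝟙 m)
  atom-0-even : atom 0 (2 * m) ≡ 0
  atom-0-even = trans (atom-0≗X^1⊗dilate-geom-1 (2 * m)) (X^1⊗dilate-even (geom 1) m)

gfPartial-odd : ∀ I m → 1 + gfPartial (suc I) (1 + 2 * m) ≡ 2 * (geom 1 ⊗ gfPartial I) m
gfPartial-odd I m = begin
  1 + (𝟙 (1 + 2 * m) + Σ< (suc I) term (1 + 2 * m))
    ≡⟨ cong (λ x → 1 + (𝟙 (1 + 2 * m) + x)) (Σ<-term-suc I (1 + 2 * m)) ⟩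
  1 + (atom 0 (1 + 2 * m) + (dilate (Σ< I term) (1 + 2 * m) + 2 * (X^ 1 ⊗ dilate (geom 1 ⊗ Σ< I term)) (1 + 2 * m)))
    ≡⟨ cong (1 +_) (cong₂ _+_ atom-0-odd (cong₂ _+_ (dilate-odd (Σ< I term) m) (cong (2 *_) (X^1⊗dilate-odd _ m)))) ⟩
  2 + 2 * (geom 1 ⊗ Σ< I term) m
    ≡⟨ *-distribˡ-+ 2 1 _ ⟨
  2 * (1 + (geom 1 ⊗ Σ< I term) m)
    ≡⟨ cong (λ x → 2 * (x + (geom 1 ⊗ Σ< I term) m)) (trans (⊗-identityʳ (geom 1) m) (geom-1 m)) ⟨
  2 * ((geom 1 ⊗ 𝟙) m + (geom 1 ⊗ Σ< I term) m)
    ≡⟨ cong (2 *_) (⊗-distribˡ-⊕ (geom 1) 𝟙 (Σ< I term) m) ⟨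
  2 * (geom 1 ⊗ gfPartial I) m  ∎
  where
  open ≡-Reasoning
  atom-0-odd : atom 0 (1 + 2 * m) ≡ 1
  atom-0-odd = trans (atom-0≗X^1⊗dilate-geom-1 (1 + 2 * m)) (trans (X^1⊗dilate-odd (geom 1) m) (geom-1 m))

2*m<2*n⇒m<n : ∀ {m n} → 2 * m < 2 * n → m < n
2*m<2*n⇒m<n {m} {n} = *-cancelˡ-< 2 m n

sp≡gfPartial : ∀ I n → n < 2 ^ I → sp n ≡ gfPartial I n
sp≡gfPartial zero zero _ = refl
sp≡gfPartial zero (suc n) (s≤s ())
sp≡gfPartial (suc I) n n<2^[1+I] with parity n
... | even m = begin
  sp (2 * m)                  ≡⟨ sp-double m ⟩
  sp m                        ≡⟨ sp≡gfPartial I m (2*m<2*n⇒m<n n<2^[1+I]) ⟩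
  gfPartial I m               ≡⟨ gfPartial-even I m ⟨
  gfPartial (suc I) (2 * m)   ∎
  where open ≡-Reasoning
... | odd m = +-cancelˡ-≡ 1 _ _ (begin
  1 + sp (1 + 2 * m)                     ≡⟨ sp-odd-prefix-sum m ⟩
  2 * (geom 1 ⊗ sp) m                    ≡⟨ cong (2 *_) (prefix-sum-cong m (λ j j≤m → sp≡gfPartial I j (≤-<-trans j≤m m<2^I))) ⟩
  2 * (geom 1 ⊗ gfPartial I) m           ≡⟨ gfPartial-odd I m ⟨
  1 + gfPartial (suc I) (1 + 2 * m)      ∎)
  where
  open ≡-Reasoning
  m<2^I : m < 2 ^ I
  m<2^I = 2*m<2*n⇒m<n (<-trans (n<1+n (2 * m)) n<2^[1+I])

-- Unimodal compositions

data Unimodal : List ℕ → Set where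
  []   : Unimodal []
  peak : ∀ {c bs} → Linked _≥′_ bs → All (_< c) bs → Unimodal (c ∷ bs)
  rise : ∀ {x y ys} → x ≤ y → Unimodal (y ∷ ys) → Unimodal (x ∷ y ∷ ys)

weaklyUnimodal⇒unimodal : ∀ {xs} → WeaklyUnimodal xs → Unimodal xs
weaklyUnimodal⇒unimodal (inj₁ refl) = []
weaklyUnimodal⇒unimodal (inj₂ (as , c , bs , refl , ascending , below-c , descending)) = go as ascending
  where
  go : ∀ as → Linked _≤_ (as ++ [ c ]) → Unimodal (as ++ c ∷ bs)
  go [] _ = peak descending below-c
  go (a ∷ []) (a≤c ∷ _) = rise a≤c (peak descending below-c)
  go (a ∷ a′ ∷ as) (a≤a′ ∷ l) = rise a≤a′ (go (a′ ∷ as) l)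

unimodal⇒weaklyUnimodal : ∀ {xs} → Unimodal xs → WeaklyUnimodal xs
unimodal⇒weaklyUnimodal [] = inj₁ refl
unimodal⇒weaklyUnimodal (peak descending below-c) = inj₂ ([] , _ , _ , refl , [-] , below-c , descending)
unimodal⇒weaklyUnimodal (rise {x} x≤y u) with unimodal⇒weaklyUnimodal u
... | inj₂ ([] , c , bs , refl , l , below-c , descending) =
  inj₂ (x ∷ [] , c , bs , refl , x≤y ∷ l , below-c , descending)
... | inj₂ (a ∷ as , c , bs , refl , l , below-c , descending) =
  inj₂ (x ∷ a ∷ as , c , bs , refl , x≤y ∷ l , below-c , descending)

nonincreasing-head : ∀ {x xs} → Linked _≥′_ (x ∷ xs) → All (_≤ x) xs
nonincreasing-head l = AllPairs.head (Linked.Linked⇒AllPairs (λ p q → ≤-trans q p) l)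

nonincreasing⇒unimodal : ∀ {ys} → Linked _≥′_ ys → Unimodal ys
nonincreasing⇒unimodal [] = []
nonincreasing⇒unimodal [-] = peak [] []
nonincreasing⇒unimodal {y ∷ z ∷ zs} (z≤y ∷ l) with z <? y
... | yes z<y = peak l (z<y ∷ All.map (λ w≤z → ≤-<-trans w≤z z<y) (nonincreasing-head l))
... | no z≮y = rise (≮⇒≥ z≮y) (nonincreasing⇒unimodal l)

Unimodal-tail : ∀ {x ys} → Unimodal (x ∷ ys) → Unimodal ys
Unimodal-tail (peak descending _) = nonincreasing⇒unimodal descending
Unimodal-tail (rise _ u) = u

Unimodal-∷ : ∀ {x ys} → All (x ≤_) ys → Unimodal ys → Unimodal (x ∷ ys)
Unimodal-∷ [] [] = peak [] []
Unimodal-∷ (x≤y ∷ _) u = rise x≤y u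

Linked-init : ∀ {R : ℕ → ℕ → Set} xs {x} → Linked R (xs ∷ʳ x) → Linked R xs
Linked-init [] _ = []
Linked-init (a ∷ []) _ = [-]
Linked-init (a ∷ b ∷ bs) (r ∷ l) = r ∷ Linked-init (b ∷ bs) l

Linked-∷ʳ : ∀ {R : ℕ → ℕ → Set} {xs x} → Linked R xs → All (λ z → R z x) xs → Linked R (xs ∷ʳ x)
Linked-∷ʳ [] _ = [-]
Linked-∷ʳ [-] (r ∷ []) = r ∷ [-]
Linked-∷ʳ (r ∷ l) (_ ∷ rs) = r ∷ Linked-∷ʳ l rs

Unimodal-init : ∀ ys {x} → Unimodal (ys ∷ʳ x) → Unimodal ys
Unimodal-init [] _ = []
Unimodal-init (y ∷ []) _ = peak [] []
Unimodal-init (y ∷ z ∷ zs) (peak descending below-y) =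
  peak (Linked-init (z ∷ zs) descending) (All.++⁻ˡ (z ∷ zs) below-y)
Unimodal-init (y ∷ z ∷ zs) (rise y≤z u) = rise y≤z (Unimodal-init (z ∷ zs) u)

Unimodal-∷ʳ : ∀ {x ys} → Any (x <_) ys → All (x ≤_) ys → Unimodal ys → Unimodal (ys ∷ʳ x)
Unimodal-∷ʳ {x} x<y (_ ∷ x≤ys) (peak {c} {bs} descending below-c) =
  peak (Linked-∷ʳ descending x≤ys) (All.++⁺ below-c (x<c x<y ∷ []))
  where
  x<c : Any (x <_) (c ∷ bs) → x < c
  x<c (here x<c) = x<c
  x<c (there x<b) = All.lookupWith (λ b<c x<b → <-trans x<b b<c) below-c x<b
Unimodal-∷ʳ (here x<y) (_ ∷ x≤ys) (rise y≤z u) = rise y≤z (Unimodal-∷ʳ (here (<-≤-trans x<y y≤z)) x≤ys u)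
Unimodal-∷ʳ (there x<ys) (_ ∷ x≤ys) (rise y≤z u) = rise y≤z (Unimodal-∷ʳ x<ys x≤ys u)

Linked-drop : ∀ {R : ℕ → ℕ → Set} p {q} → Linked R (p ++ q) → Linked R q
Linked-drop [] l = l
Linked-drop (a ∷ []) [-] = []
Linked-drop (a ∷ []) (_ ∷ l) = l
Linked-drop (a ∷ b ∷ p) (_ ∷ l) = Linked-drop (b ∷ p) l

nonincreasing-no-rise : ∀ {x r} → Linked _≥′_ (x ∷ r) → ¬ Any (x <_) r
nonincreasing-no-rise l = All¬⇒¬Any (All.map ≤⇒≯ (nonincreasing-head l))

Unimodal-no-valley : ∀ {x} y p r → Unimodal (y ∷ p ++ x ∷ r) → All (x <_) (y ∷ p) → ¬ Any (x <_) r
Unimodal-no-valley y [] r (peak descending _) _ = nonincreasing-no-rise descending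
Unimodal-no-valley y [] r (rise y≤x _) (x<y ∷ _) _ = <⇒≱ x<y y≤x
Unimodal-no-valley y (z ∷ p) r (peak descending _) _ = nonincreasing-no-rise (Linked-drop (z ∷ p) descending)
Unimodal-no-valley y (z ∷ p) r (rise _ u) (_ ∷ x<p) = Unimodal-no-valley z p r u x<p

module _ {f : ℕ → ℕ} (f-mono-≤ : ∀ {a b} → a ≤ b → f a ≤ f b) (f-mono-< : ∀ {a b} → a < b → f a < f b) where

  Unimodal-map⁺ : ∀ {xs} → Unimodal xs → Unimodal (map f xs)
  Unimodal-map⁺ [] = []
  Unimodal-map⁺ (peak descending below-c) =
    peak (Linked.map⁺ (Linked.map f-mono-≤ descending)) (All.map⁺ (All.map f-mono-< below-c))
  Unimodal-map⁺ (rise x≤y u) = rise (f-mono-≤ x≤y) (Unimodal-map⁺ u)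

module _ {f : ℕ → ℕ} (f-cancel-≤ : ∀ {a b} → f a ≤ f b → a ≤ b) (f-cancel-< : ∀ {a b} → f a < f b → a < b) where

  Unimodal-map⁻ : ∀ xs → Unimodal (map f xs) → Unimodal xs
  Unimodal-map⁻ [] _ = []
  Unimodal-map⁻ (y ∷ []) _ = peak [] []
  Unimodal-map⁻ (y ∷ z ∷ zs) (peak descending below-c) =
    peak (Linked.map f-cancel-≤ (Linked.map⁻ descending)) (All.map f-cancel-< (All.map⁻ below-c))
  Unimodal-map⁻ (y ∷ z ∷ zs) (rise fy≤fz u) = rise (f-cancel-≤ fy≤fz) (Unimodal-map⁻ (z ∷ zs) u)

Odd-1 : Odd 1
Odd-1 = ¬2∣1+2*m 0

¬Odd-0 : ¬ Odd 0
¬Odd-0 0-odd = 0-odd (divides 0 refl)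

¬Odd-2 : ¬ Odd 2
¬Odd-2 2-odd = 2-odd ∣-refl

Odd-2+ : ∀ {m} → Odd m → Odd (2 + m)
Odd-2+ m-odd 2∣2+m = m-odd (∣m+n∣m⇒∣n 2∣2+m ∣-refl)

Odd-2+⁻ : ∀ {m} → Odd (2 + m) → Odd m
Odd-2+⁻ 2+m-odd 2∣m = 2+m-odd (∣m∣n⇒∣m+n ∣-refl 2∣m)

-- SingleOddBlocks xs unfolds to ∀ v → v ∈ xs → Block v xs.
Block : ℕ → List ℕ → Set
Block v xs = Σ (List ℕ) λ p → Σ ℕ λ m → Σ (List ℕ) λ q →
  xs ≡ p ++ replicate m v ++ q × v ∉ p × v ∉ q × Odd m

Block-∷ : ∀ {v x xs} → v ≢ x → Block v xs → Block v (x ∷ xs)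
Block-∷ {v} {x} v≢x (p , m , q , refl , v∉p , v∉q , m-odd) = x ∷ p , m , q , refl , v∉x∷p , v∉q , m-odd
  where
  v∉x∷p : v ∉ x ∷ p
  v∉x∷p (here v≡x) = v≢x v≡x
  v∉x∷p (there v∈p) = v∉p v∈p

Block-∷⁻ : ∀ {v x xs} → v ≢ x → Block v (x ∷ xs) → Block v xs
Block-∷⁻ v≢x ([] , zero , q , _ , _ , _ , m-odd) = contradiction m-odd ¬Odd-0
Block-∷⁻ v≢x ([] , suc m , q , refl , _ , _ , _) = contradiction refl v≢x
Block-∷⁻ v≢x (_ ∷ p , m , q , refl , v∉p , v∉q , m-odd) = p , m , q , refl , v∉p ∘ there , v∉q , m-odd

Block-head : ∀ {x xs} → Block x (x ∷ xs) →
  Σ ℕ λ m → Σ (List ℕ) λ q → x ∷ xs ≡ replicate m x ++ q × x ∉ q × Odd m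
Block-head ([] , m , q , e , _ , x∉q , m-odd) = m , q , e , x∉q , m-odd
Block-head (_ ∷ p , m , q , refl , x∉p , _ , _) = contradiction (here refl) x∉p

SingleOddBlocks-∷ : ∀ {x ys} → x ∉ ys → SingleOddBlocks ys → SingleOddBlocks (x ∷ ys)
SingleOddBlocks-∷ {x} {ys} x∉ys blocks v (here refl) = [] , 1 , ys , refl , (λ ()) , x∉ys , Odd-1
SingleOddBlocks-∷ x∉ys blocks v (there v∈ys) = Block-∷ (λ { refl → x∉ys v∈ys }) (blocks v v∈ys)

SingleOddBlocks-∷⁻ : ∀ {x ys} → x ∉ ys → SingleOddBlocks (x ∷ ys) → SingleOddBlocks ys
SingleOddBlocks-∷⁻ x∉ys blocks v v∈ys = Block-∷⁻ (λ { refl → x∉ys v∈ys }) (blocks v (there v∈ys))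

SingleOddBlocks-∷∷∷ : ∀ {x ys} → SingleOddBlocks (x ∷ ys) → SingleOddBlocks (x ∷ x ∷ x ∷ ys)
SingleOddBlocks-∷∷∷ {x} blocks v v∈ with v ≟ x
... | yes refl with Block-head (blocks x (here refl))
...   | m , q , e , x∉q , m-odd = [] , 2 + m , q , cong (λ l → x ∷ x ∷ l) e , (λ ()) , x∉q , Odd-2+ m-odd
SingleOddBlocks-∷∷∷ {x} {ys} blocks v v∈ | no v≢x = Block-∷ v≢x (Block-∷ v≢x (blocks v (drop-two v∈)))
  where
  drop-two : v ∈ x ∷ x ∷ x ∷ ys → v ∈ x ∷ ys
  drop-two (here v≡x) = contradiction v≡x v≢x
  drop-two (there (here v≡x)) = contradiction v≡x v≢x
  drop-two (there (there v∈)) = v∈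

SingleOddBlocks-∷∷∷⁻ : ∀ {x ys} → SingleOddBlocks (x ∷ x ∷ x ∷ ys) → SingleOddBlocks (x ∷ ys)
SingleOddBlocks-∷∷∷⁻ {x} blocks v v∈ with v ≟ x
... | no v≢x = Block-∷⁻ v≢x (Block-∷⁻ v≢x (blocks v (there (there v∈))))
... | yes refl with Block-head (blocks x (here refl))
...   | zero , _ , _ , _ , m-odd = contradiction m-odd ¬Odd-0
...   | suc zero , _ , refl , x∉q , _ = contradiction (here refl) x∉q
...   | suc (suc zero) , _ , _ , _ , m-odd = contradiction m-odd ¬Odd-2
...   | suc (suc (suc m)) , q , refl , x∉q , m-odd = [] , suc m , q , refl , (λ ()) , x∉q , Odd-2+⁻ m-odd

replicate-∷ʳ : ∀ m (v : ℕ) → replicate m v ∷ʳ v ≡ v ∷ replicate m v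
replicate-∷ʳ zero v = refl
replicate-∷ʳ (suc m) v = cong (v ∷_) (replicate-∷ʳ m v)

reverse-replicate : ∀ m (v : ℕ) → reverse (replicate m v) ≡ replicate m v
reverse-replicate zero v = refl
reverse-replicate (suc m) v = begin
  reverse (v ∷ replicate m v)      ≡⟨ unfold-reverse v (replicate m v) ⟩
  reverse (replicate m v) ∷ʳ v     ≡⟨ cong (_∷ʳ v) (reverse-replicate m v) ⟩
  replicate m v ∷ʳ v               ≡⟨ replicate-∷ʳ m v ⟩
  v ∷ replicate m v                ∎
  where open ≡-Reasoning

∷ʳ-∷ʳ-∷ʳ : ∀ zs (x : ℕ) → ((zs ∷ʳ x) ∷ʳ x) ∷ʳ x ≡ zs ++ x ∷ x ∷ x ∷ []
∷ʳ-∷ʳ-∷ʳ [] x = refl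
∷ʳ-∷ʳ-∷ʳ (z ∷ zs) x = cong (z ∷_) (∷ʳ-∷ʳ-∷ʳ zs x)

++-replicate-suc : ∀ p m (v : ℕ) → p ++ replicate (suc m) v ≡ (p ++ replicate m v) ∷ʳ v
++-replicate-suc p m v = trans (cong (p ++_) (sym (replicate-∷ʳ m v))) (sym (++-assoc p (replicate m v) [ v ]))

++-replicate-3+ : ∀ p m (v : ℕ) → p ++ replicate (3 + m) v ≡ (p ++ replicate m v) ++ v ∷ v ∷ v ∷ []
++-replicate-3+ p m v = begin
  p ++ replicate (3 + m) v                          ≡⟨ ++-replicate-suc p (2 + m) v ⟩
  (p ++ replicate (2 + m) v) ∷ʳ v                   ≡⟨ cong (_∷ʳ v) (++-replicate-suc p (suc m) v) ⟩
  ((p ++ replicate (suc m) v) ∷ʳ v) ∷ʳ v            ≡⟨ cong (λ l → (l ∷ʳ v) ∷ʳ v) (++-replicate-suc p m v) ⟩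
  (((p ++ replicate m v) ∷ʳ v) ∷ʳ v) ∷ʳ v           ≡⟨ ∷ʳ-∷ʳ-∷ʳ (p ++ replicate m v) v ⟩
  (p ++ replicate m v) ++ v ∷ v ∷ v ∷ []            ∎
  where open ≡-Reasoning

SingleOddBlocks-reverse : ∀ {xs} → SingleOddBlocks xs → SingleOddBlocks (reverse xs)
SingleOddBlocks-reverse {xs} blocks v v∈ with blocks v (Any.reverse⁻ v∈)
... | p , m , q , refl , v∉p , v∉q , m-odd =
  reverse q , m , reverse p , reverse-block , v∉q ∘ Any.reverse⁻ , v∉p ∘ Any.reverse⁻ , m-odd
  where
  open ≡-Reasoning
  reverse-block : reverse (p ++ replicate m v ++ q) ≡ reverse q ++ replicate m v ++ reverse p
  reverse-block = begin
    reverse (p ++ replicate m v ++ q)                   ≡⟨ reverse-++ p _ ⟩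
    reverse (replicate m v ++ q) ++ reverse p           ≡⟨ cong (_++ reverse p) (reverse-++ (replicate m v) q) ⟩
    (reverse q ++ reverse (replicate m v)) ++ reverse p ≡⟨ cong (λ r → (reverse q ++ r) ++ reverse p) (reverse-replicate m v) ⟩
    (reverse q ++ replicate m v) ++ reverse p           ≡⟨ ++-assoc (reverse q) _ _ ⟩
    reverse q ++ replicate m v ++ reverse p             ∎

SingleOddBlocks-reverse⁻ : ∀ {xs} → SingleOddBlocks (reverse xs) → SingleOddBlocks xs
SingleOddBlocks-reverse⁻ {xs} blocks = subst SingleOddBlocks (reverse-involutive xs) (SingleOddBlocks-reverse blocks)

SingleOddBlocks-∷ʳ : ∀ {x ys} → x ∉ ys → SingleOddBlocks ys → SingleOddBlocks (ys ∷ʳ x)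
SingleOddBlocks-∷ʳ {x} {ys} x∉ys blocks = SingleOddBlocks-reverse⁻
  (subst SingleOddBlocks (sym (reverse-++ ys [ x ])) (SingleOddBlocks-∷ (x∉ys ∘ Any.reverse⁻) (SingleOddBlocks-reverse blocks)))

SingleOddBlocks-∷ʳ⁻ : ∀ {x ys} → x ∉ ys → SingleOddBlocks (ys ∷ʳ x) → SingleOddBlocks ys
SingleOddBlocks-∷ʳ⁻ {x} {ys} x∉ys blocks = SingleOddBlocks-reverse⁻
  (SingleOddBlocks-∷⁻ (x∉ys ∘ Any.reverse⁻) (subst SingleOddBlocks (reverse-++ ys [ x ]) (SingleOddBlocks-reverse blocks)))

SingleOddBlocks-∷ʳ∷ʳ∷ʳ : ∀ {x ys} → SingleOddBlocks (ys ∷ʳ x) → SingleOddBlocks (ys ++ x ∷ x ∷ x ∷ [])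
SingleOddBlocks-∷ʳ∷ʳ∷ʳ {x} {ys} blocks = SingleOddBlocks-reverse⁻
  (subst SingleOddBlocks (sym (reverse-++ ys (x ∷ x ∷ x ∷ [])))
    (SingleOddBlocks-∷∷∷ (subst SingleOddBlocks (reverse-++ ys [ x ]) (SingleOddBlocks-reverse blocks))))

SingleOddBlocks-∷ʳ∷ʳ∷ʳ⁻ : ∀ {x ys} → SingleOddBlocks (ys ++ x ∷ x ∷ x ∷ []) → SingleOddBlocks (ys ∷ʳ x)
SingleOddBlocks-∷ʳ∷ʳ∷ʳ⁻ {x} {ys} blocks = SingleOddBlocks-reverse⁻
  (subst SingleOddBlocks (sym (reverse-++ ys [ x ]))
    (SingleOddBlocks-∷∷∷⁻ (subst SingleOddBlocks (reverse-++ ys (x ∷ x ∷ x ∷ [])) (SingleOddBlocks-reverse blocks))))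

map-++⁻ : ∀ (f : ℕ → ℕ) xs {ys zs} → map f xs ≡ ys ++ zs →
  Σ (List ℕ) λ xs₁ → Σ (List ℕ) λ xs₂ → xs ≡ xs₁ ++ xs₂ × map f xs₁ ≡ ys × map f xs₂ ≡ zs
map-++⁻ f xs {[]} e = [] , xs , refl , refl , e
map-++⁻ f (x ∷ xs) {y ∷ ys} e with ∷-injective e
... | refl , e′ with map-++⁻ f xs {ys} e′
...   | xs₁ , xs₂ , refl , refl , refl = x ∷ xs₁ , xs₂ , refl , refl , refl

map-replicate⁻ : ∀ {f : ℕ → ℕ} → Injective _≡_ _≡_ f → ∀ xs m w → map f xs ≡ replicate m (f w) → xs ≡ replicate m w
map-replicate⁻ f-inj [] zero w _ = refl
map-replicate⁻ f-inj (x ∷ xs) (suc m) w e with ∷-injective e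
... | fx≡fw , e′ = cong₂ _∷_ (f-inj fx≡fw) (map-replicate⁻ f-inj xs m w e′)

module _ {f : ℕ → ℕ} (f-inj : Injective _≡_ _≡_ f) where

  ∉-map⁺ : ∀ {w xs} → w ∉ xs → f w ∉ map f xs
  ∉-map⁺ w∉xs fw∈ with ∈-map⁻ f fw∈
  ... | w′ , w′∈xs , fw≡fw′ = w∉xs (subst (_∈ _) (sym (f-inj fw≡fw′)) w′∈xs)

  SingleOddBlocks-map⁺ : ∀ {ys} → SingleOddBlocks ys → SingleOddBlocks (map f ys)
  SingleOddBlocks-map⁺ blocks v v∈ with ∈-map⁻ f v∈
  ... | w , w∈ys , refl with blocks w w∈ys
  ...   | p , m , q , refl , w∉p , w∉q , m-odd =
    map f p , m , map f q , map-block , ∉-map⁺ w∉p , ∉-map⁺ w∉q , m-odd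
    where
    map-block : map f (p ++ replicate m w ++ q) ≡ map f p ++ replicate m (f w) ++ map f q
    map-block = trans (map-++ f p _) (cong (map f p ++_)
      (trans (map-++ f (replicate m w) q) (cong (_++ map f q) (map-replicate f m w))))

  SingleOddBlocks-map⁻ : ∀ {ys} → SingleOddBlocks (map f ys) → SingleOddBlocks ys
  SingleOddBlocks-map⁻ {ys} blocks w w∈ys with blocks (f w) (∈-map⁺ f w∈ys)
  ... | p , m , q , e , fw∉p , fw∉q , m-odd with map-++⁻ f ys {p} e
  ...   | ys₁ , ys₂ , refl , refl , e₂ with map-++⁻ f ys₂ {replicate m (f w)} e₂
  ...     | ys₂₁ , ys₂₂ , refl , e₂₁ , refl with map-replicate⁻ f-inj ys₂₁ m w e₂₁
  ...       | refl = ys₁ , m , ys₂₂ , refl , fw∉p ∘ ∈-map⁺ f , fw∉q ∘ ∈-map⁺ f , m-odd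

Image : (List ℕ → List ℕ) → (List ℕ → Set) → List ℕ → Set
Image f P ys = Σ (List ℕ) λ xs → P xs × ys ≡ f xs

HasCount-resp : ∀ {P Q : List ℕ → Set} {k} → (∀ {xs} → P xs → Q xs) → (∀ {xs} → Q xs → P xs) → HasCount P k → HasCount Q k
HasCount-resp P⇒Q Q⇒P (L , unique , ∈L⇔P , length≡) =
  L , unique , (λ xs → mk⇔ (P⇒Q ∘ Equivalence.to (∈L⇔P xs)) (Equivalence.from (∈L⇔P xs) ∘ Q⇒P)) , length≡

HasCount-≡ : ∀ xs → HasCount (_≡ xs) 1
HasCount-≡ xs = xs ∷ [] , [] ∷ [] , (λ ys → mk⇔ to (λ { refl → here refl })) , refl
  where
  to : ∀ {ys} → ys ∈ xs ∷ [] → ys ≡ xs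
  to (here ys≡xs) = ys≡xs

HasCount-image : ∀ {P : List ℕ → Set} {k} {f : List ℕ → List ℕ} → Injective _≡_ _≡_ f → HasCount P k → HasCount (Image f P) k
HasCount-image {f = f} f-inj (L , unique , ∈L⇔P , length≡) =
  map f L , Unique.map⁺ f-inj unique , ∈map⇔Image , trans (length-map f L) length≡
  where
  ∈map⇔Image : ∀ ys → (ys ∈ map f L) ⇔ Image f _ ys
  ∈map⇔Image ys = mk⇔ to from
    where
    to : ys ∈ map f L → Image f _ ys
    to ys∈ with ∈-map⁻ f ys∈
    ... | xs , xs∈L , refl = xs , Equivalence.to (∈L⇔P xs) xs∈L , refl
    from : Image f _ ys → ys ∈ map f L
    from (xs , Pxs , refl) = ∈-map⁺ f (Equivalence.from (∈L⇔P xs) Pxs)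

HasCount-⊎ : ∀ {P Q : List ℕ → Set} {a b} → (∀ {xs} → P xs → ¬ Q xs) →
  HasCount P a → HasCount Q b → HasCount (λ xs → P xs ⊎ Q xs) (a + b)
HasCount-⊎ {P} {Q} P⇒¬Q (L₁ , unique₁ , ∈L₁⇔P , length≡₁) (L₂ , unique₂ , ∈L₂⇔Q , length≡₂) =
  L₁ ++ L₂ , Unique.++⁺ unique₁ unique₂ disjoint , ∈++⇔⊎ ,
  trans (length-++ L₁) (cong₂ _+_ length≡₁ length≡₂)
  where
  disjoint : ∀ {xs} → ¬ (xs ∈ L₁ × xs ∈ L₂)
  disjoint {xs} (xs∈L₁ , xs∈L₂) = P⇒¬Q (Equivalence.to (∈L₁⇔P xs) xs∈L₁) (Equivalence.to (∈L₂⇔Q xs) xs∈L₂)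
  ∈++⇔⊎ : ∀ xs → (xs ∈ L₁ ++ L₂) ⇔ (P xs ⊎ Q xs)
  ∈++⇔⊎ xs = mk⇔ to from
    where
    to : xs ∈ L₁ ++ L₂ → P xs ⊎ Q xs
    to xs∈ with ∈-++⁻ L₁ xs∈
    ... | inj₁ xs∈L₁ = inj₁ (Equivalence.to (∈L₁⇔P xs) xs∈L₁)
    ... | inj₂ xs∈L₂ = inj₂ (Equivalence.to (∈L₂⇔Q xs) xs∈L₂)
    from : P xs ⊎ Q xs → xs ∈ L₁ ++ L₂
    from (inj₁ Pxs) = ∈-++⁺ˡ (Equivalence.from (∈L₁⇔P xs) Pxs)
    from (inj₂ Qxs) = ∈-++⁺ʳ L₁ (Equivalence.from (∈L₂⇔Q xs) Qxs)

IsPowerOf2-1 : IsPowerOf2 1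
IsPowerOf2-1 = 0 , refl

IsPowerOf2-2* : ∀ {x} → IsPowerOf2 x → IsPowerOf2 (2 * x)
IsPowerOf2-2* (k , refl) = suc k , refl

IsPowerOf2⇒>0 : ∀ {x} → IsPowerOf2 x → 0 < x
IsPowerOf2⇒>0 (k , refl) = m^n>0 2 k

IsPowerOf2-half : ∀ {x} → IsPowerOf2 x → x ≢ 1 → Σ ℕ λ y → IsPowerOf2 y × x ≡ 2 * y
IsPowerOf2-half (zero , x≡1) x≢1 = contradiction x≡1 x≢1
IsPowerOf2-half (suc k , x≡2^[1+k]) _ = 2 ^ k , (k , refl) , x≡2^[1+k]

IsPowerOf2⇒>1 : ∀ {x} → IsPowerOf2 x → x ≢ 1 → 1 < x
IsPowerOf2⇒>1 x-pow x≢1 with IsPowerOf2-half x-pow x≢1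
... | y , y-pow , refl = *-monoʳ-≤ 2 (IsPowerOf2⇒>0 y-pow)

All-IsPowerOf2⇒>1 : ∀ {xs} → All IsPowerOf2 xs → 1 ∉ xs → All (1 <_) xs
All-IsPowerOf2⇒>1 [] _ = []
All-IsPowerOf2⇒>1 (x-pow ∷ xs-pow) 1∉x∷xs =
  IsPowerOf2⇒>1 x-pow (λ x≡1 → 1∉x∷xs (here (sym x≡1))) ∷ All-IsPowerOf2⇒>1 xs-pow (1∉x∷xs ∘ there)

1∉⇒Any-1< : ∀ {ys} → All IsPowerOf2 ys → 1 ∉ ys → ys ≢ [] → Any (1 <_) ys
1∉⇒Any-1< [] _ []≢[] = contradiction refl []≢[]
1∉⇒Any-1< (y-pow ∷ _) 1∉y∷ys _ = here (IsPowerOf2⇒>1 y-pow (λ y≡1 → 1∉y∷ys (here (sym y≡1))))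

halve : ∀ {xs} → All IsPowerOf2 xs → 1 ∉ xs → Σ (List ℕ) λ ys → All IsPowerOf2 ys × xs ≡ map (2 *_) ys
halve [] _ = [] , [] , refl
halve (x-pow ∷ xs-pow) 1∉x∷xs
  with IsPowerOf2-half x-pow (λ x≡1 → 1∉x∷xs (here (sym x≡1))) | halve xs-pow (1∉x∷xs ∘ there)
... | y , y-pow , refl | ys , ys-pow , refl = y ∷ ys , y-pow ∷ ys-pow , refl

sum-map-2* : ∀ ys → sum (map (2 *_) ys) ≡ 2 * sum ys
sum-map-2* [] = refl
sum-map-2* (y ∷ ys) = trans (cong (2 * y +_) (sum-map-2* ys)) (sym (*-distribˡ-+ 2 y (sum ys)))

sum-replicate-1 : ∀ m → sum (replicate m 1) ≡ m
sum-replicate-1 zero = refl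
sum-replicate-1 (suc m) = cong suc (sum-replicate-1 m)

1∉⇒even-sum : ∀ {xs} → All IsPowerOf2 xs → 1 ∉ xs → 2 ∣ sum xs
1∉⇒even-sum xs-pow 1∉xs with halve xs-pow 1∉xs
... | ys , _ , refl = divides (sum ys) (trans (sum-map-2* ys) (*-comm 2 (sum ys)))

odd-sum⇒1∈ : ∀ {xs} → All IsPowerOf2 xs → ¬ 2 ∣ sum xs → 1 ∈ xs
odd-sum⇒1∈ {xs} xs-pow odd-sum with 1 ∈? xs
... | yes 1∈xs = 1∈xs
... | no 1∉xs = contradiction (1∉⇒even-sum xs-pow 1∉xs) odd-sum

even-sum⇒1∉ : ∀ {xs} → All IsPowerOf2 xs → SingleOddBlocks xs → 2 ∣ sum xs → 1 ∉ xs
even-sum⇒1∉ xs-pow blocks even-sum 1∈xs with blocks 1 1∈xs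
... | p , m , q , refl , 1∉p , 1∉q , m-odd = m-odd 2∣m
  where
  sum-p-even : 2 ∣ sum p
  sum-p-even = 1∉⇒even-sum (All.++⁻ˡ p xs-pow) 1∉p
  sum-q-even : 2 ∣ sum q
  sum-q-even = 1∉⇒even-sum (All.++⁻ʳ (replicate m 1) (All.++⁻ʳ p xs-pow)) 1∉q
  sum-split : sum (p ++ replicate m 1 ++ q) ≡ sum p + (sum q + m)
  sum-split = trans (sum-++ p _) (cong (sum p +_)
    (trans (sum-++ (replicate m 1) q) (trans (cong (_+ sum q) (sum-replicate-1 m)) (+-comm m (sum q)))))
  2∣m : 2 ∣ m
  2∣m = ∣m+n∣m⇒∣n (∣m+n∣m⇒∣n (subst (2 ∣_) sum-split even-sum) sum-p-even) sum-q-even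

sum≡0⇒[] : ∀ {xs} → All IsPowerOf2 xs → sum xs ≡ 0 → xs ≡ []
sum≡0⇒[] [] _ = refl
sum≡0⇒[] (x-pow ∷ _) sum≡0 = contradiction (m+n≡0⇒m≡0 _ sum≡0) (>⇒≢ (IsPowerOf2⇒>0 x-pow))

2*-injective : Injective _≡_ _≡_ (2 *_)
2*-injective {a} {b} = *-cancelˡ-≡ a b 2

-- The compositions counted by oc

record OC (n : ℕ) (xs : List ℕ) : Set where
  constructor mkOC
  field
    sum≡ : sum xs ≡ n
    powers : All IsPowerOf2 xs
    unimodal : Unimodal xs
    blocks : SingleOddBlocks xs

OCComposition⇒OC : ∀ {n xs} → OCComposition n xs → OC n xs
OCComposition⇒OC (sum≡ , powers , weaklyUnimodal , blocks) =
  mkOC sum≡ powers (weaklyUnimodal⇒unimodal weaklyUnimodal) blocks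

OC⇒OCComposition : ∀ {n xs} → OC n xs → OCComposition n xs
OC⇒OCComposition (mkOC sum≡ powers u blocks) = sum≡ , powers , unimodal⇒weaklyUnimodal u , blocks

OC-even⇒1∉ : ∀ {n xs} → OC n xs → 2 ∣ n → 1 ∉ xs
OC-even⇒1∉ (mkOC refl powers _ blocks) = even-sum⇒1∉ powers blocks

OC-odd⇒1∈ : ∀ {n xs} → OC n xs → ¬ 2 ∣ n → 1 ∈ xs
OC-odd⇒1∈ (mkOC refl powers _ _) = odd-sum⇒1∈ powers

OC-suc⇒≢[] : ∀ {n xs} → OC (suc n) xs → xs ≢ []
OC-suc⇒≢[] (mkOC () _ _ _) refl

OC-0 : ∀ {xs} → OC 0 xs → xs ≡ []
OC-0 (mkOC sum≡0 powers _ _) = sum≡0⇒[] powers sum≡0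

OC-[] : OC 0 []
OC-[] = mkOC refl [] [] (λ _ ())

OC-1 : ∀ {xs} → OC 1 xs → xs ≡ 1 ∷ []
OC-1 {[]} (mkOC () _ _ _)
OC-1 {zero ∷ xs} (mkOC _ (0-pow ∷ _) _ _) = contradiction (IsPowerOf2⇒>0 0-pow) (λ ())
OC-1 {suc zero ∷ xs} (mkOC sum≡1 (_ ∷ xs-pow) _ _) = cong (1 ∷_) (sum≡0⇒[] xs-pow (suc-injective sum≡1))
OC-1 {suc (suc x) ∷ xs} (mkOC () _ _ _)

OC-[1] : OC 1 (1 ∷ [])
OC-[1] = mkOC refl (IsPowerOf2-1 ∷ []) (peak [] []) (SingleOddBlocks-∷ (λ ()) (λ _ ()))

OC-2* : ∀ {k ys} → OC k ys → OC (2 * k) (map (2 *_) ys)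
OC-2* {ys = ys} (mkOC refl powers u blocks) = mkOC (sum-map-2* ys)
  (All.map⁺ (All.map IsPowerOf2-2* powers))
  (Unimodal-map⁺ (*-monoʳ-≤ 2) (*-monoʳ-< 2) u)
  (SingleOddBlocks-map⁺ 2*-injective blocks)

OC-2*⁻ : ∀ {k xs} → OC (2 * k) xs → Image (map (2 *_)) (OC k) xs
OC-2*⁻ {k} oc@(mkOC sum≡2k powers u blocks) with halve powers (OC-even⇒1∉ oc (m∣m*n k))
... | ys , ys-pow , refl = ys , oc′ , refl
  where
  oc′ : OC k ys
  oc′ = mkOC (2*-injective (trans (sym (sum-map-2* ys)) sum≡2k)) ys-pow
    (Unimodal-map⁻ (*-cancelˡ-≤ 2) (*-cancelˡ-< 2 _ _) ys u)
    (SingleOddBlocks-map⁻ 2*-injective blocks)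

sum-∷ʳ : ∀ ys x → sum (ys ∷ʳ x) ≡ sum ys + x
sum-∷ʳ ys x = trans (sum-++ ys [ x ]) (cong (sum ys +_) (+-identityʳ x))

OC-∷ : ∀ {n ys} → 1 ∉ ys → OC n ys → OC (suc n) (1 ∷ ys)
OC-∷ 1∉ys (mkOC sum≡ powers u blocks) = mkOC (cong suc sum≡) (IsPowerOf2-1 ∷ powers)
  (Unimodal-∷ (All.map IsPowerOf2⇒>0 powers) u) (SingleOddBlocks-∷ 1∉ys blocks)

OC-∷⁻ : ∀ {n ys} → 1 ∉ ys → OC (suc n) (1 ∷ ys) → OC n ys
OC-∷⁻ 1∉ys (mkOC sum≡ (_ ∷ powers) u blocks) =
  mkOC (suc-injective sum≡) powers (Unimodal-tail u) (SingleOddBlocks-∷⁻ 1∉ys blocks)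

OC-∷ʳ : ∀ {n ys} → 1 ∉ ys → Any (1 <_) ys → OC n ys → OC (suc n) (ys ∷ʳ 1)
OC-∷ʳ {ys = ys} 1∉ys 1<ys (mkOC sum≡ powers u blocks) =
  mkOC (trans (sum-∷ʳ ys 1) (trans (+-comm _ 1) (cong suc sum≡))) (All.++⁺ powers (IsPowerOf2-1 ∷ []))
    (Unimodal-∷ʳ 1<ys (All.map IsPowerOf2⇒>0 powers) u) (SingleOddBlocks-∷ʳ 1∉ys blocks)

OC-∷ʳ⁻ : ∀ {n ys} → 1 ∉ ys → OC (suc n) (ys ∷ʳ 1) → OC n ys
OC-∷ʳ⁻ {ys = ys} 1∉ys (mkOC sum≡ powers u blocks) =
  mkOC (suc-injective (trans (trans (+-comm 1 _) (sym (sum-∷ʳ ys 1))) sum≡)) (All.++⁻ˡ ys powers)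
    (Unimodal-init ys u) (SingleOddBlocks-∷ʳ⁻ 1∉ys blocks)

OC-∷∷∷ : ∀ {n zs} → OC n (1 ∷ zs) → OC (2 + n) (1 ∷ 1 ∷ 1 ∷ zs)
OC-∷∷∷ (mkOC sum≡ powers u blocks) = mkOC (cong (2 +_) sum≡) (IsPowerOf2-1 ∷ IsPowerOf2-1 ∷ powers)
  (rise ≤-refl (rise ≤-refl u)) (SingleOddBlocks-∷∷∷ blocks)

OC-∷∷∷⁻ : ∀ {n zs} → OC (2 + n) (1 ∷ 1 ∷ 1 ∷ zs) → OC n (1 ∷ zs)
OC-∷∷∷⁻ (mkOC sum≡ (_ ∷ _ ∷ powers) u blocks) =
  mkOC (suc-injective (suc-injective sum≡)) powers (Unimodal-tail (Unimodal-tail u)) (SingleOddBlocks-∷∷∷⁻ blocks)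

sum-∷ʳ∷ʳ∷ʳ : ∀ zs → sum (zs ++ 1 ∷ 1 ∷ 1 ∷ []) ≡ 2 + sum (zs ∷ʳ 1)
sum-∷ʳ∷ʳ∷ʳ zs = begin
  sum (zs ++ 1 ∷ 1 ∷ 1 ∷ [])   ≡⟨ sum-++ zs _ ⟩
  sum zs + 3                   ≡⟨ +-comm (sum zs) 3 ⟩
  2 + (1 + sum zs)             ≡⟨ cong (2 +_) (+-comm 1 (sum zs)) ⟩
  2 + (sum zs + 1)             ≡⟨ cong (2 +_) (sum-∷ʳ zs 1) ⟨
  2 + sum (zs ∷ʳ 1)            ∎
  where open ≡-Reasoning

OC-∷ʳ∷ʳ∷ʳ : ∀ {n zs} → Any (1 <_) zs → OC n (zs ∷ʳ 1) → OC (2 + n) (zs ++ 1 ∷ 1 ∷ 1 ∷ [])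
OC-∷ʳ∷ʳ∷ʳ {zs = zs} 1<zs (mkOC sum≡ powers u blocks) =
  mkOC (trans (sum-∷ʳ∷ʳ∷ʳ zs) (cong (2 +_) sum≡))
    (All.++⁺ (All.++⁻ˡ zs powers) (IsPowerOf2-1 ∷ IsPowerOf2-1 ∷ IsPowerOf2-1 ∷ []))
    (subst Unimodal (∷ʳ-∷ʳ-∷ʳ zs 1)
      (Unimodal-∷ʳ (Any.++⁺ˡ (Any.++⁺ˡ 1<zs)) (All.++⁺ 1≤zs∷ʳ1 (≤-refl ∷ []))
        (Unimodal-∷ʳ (Any.++⁺ˡ 1<zs) 1≤zs∷ʳ1 u)))
    (SingleOddBlocks-∷ʳ∷ʳ∷ʳ blocks)
  where
  1≤zs∷ʳ1 : All (1 ≤_) (zs ∷ʳ 1)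
  1≤zs∷ʳ1 = All.map IsPowerOf2⇒>0 powers

OC-∷ʳ∷ʳ∷ʳ⁻ : ∀ {n zs} → OC (2 + n) (zs ++ 1 ∷ 1 ∷ 1 ∷ []) → OC n (zs ∷ʳ 1)
OC-∷ʳ∷ʳ∷ʳ⁻ {zs = zs} (mkOC sum≡ powers u blocks) =
  mkOC (suc-injective (suc-injective (trans (sym (sum-∷ʳ∷ʳ∷ʳ zs)) sum≡)))
    (All.++⁺ (All.++⁻ˡ zs powers) (IsPowerOf2-1 ∷ []))
    (Unimodal-init (zs ∷ʳ 1) (Unimodal-init ((zs ∷ʳ 1) ∷ʳ 1) (subst Unimodal (sym (∷ʳ-∷ʳ-∷ʳ zs 1)) u)))
    (SingleOddBlocks-∷ʳ∷ʳ∷ʳ⁻ blocks)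

-- Adds 2 to the odd part, as in the definition of SP(n): two more 1s go in front of the first 1.
addTwoOnes : List ℕ → List ℕ
addTwoOnes [] = []
addTwoOnes (x ∷ xs) with x ≟ 1
... | yes _ = 1 ∷ 1 ∷ x ∷ xs
... | no _ = x ∷ addTwoOnes xs

addTwoOnes-++ : ∀ p r → 1 ∉ p → addTwoOnes (p ++ 1 ∷ r) ≡ p ++ 1 ∷ 1 ∷ 1 ∷ r
addTwoOnes-++ [] r _ = refl
addTwoOnes-++ (x ∷ p) r 1∉x∷p with x ≟ 1
... | yes refl = contradiction (here refl) 1∉x∷p
... | no _ = cong (x ∷_) (addTwoOnes-++ p r (1∉x∷p ∘ there))

addTwoOnes-injective : Injective _≡_ _≡_ addTwoOnes
addTwoOnes-injective {[]} {[]} _ = refl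
addTwoOnes-injective {[]} {y ∷ ys} e with y ≟ 1
addTwoOnes-injective {[]} {y ∷ ys} () | yes _
addTwoOnes-injective {[]} {y ∷ ys} () | no _
addTwoOnes-injective {x ∷ xs} {[]} e with x ≟ 1
addTwoOnes-injective {x ∷ xs} {[]} () | yes _
addTwoOnes-injective {x ∷ xs} {[]} () | no _
addTwoOnes-injective {x ∷ xs} {y ∷ ys} e with x ≟ 1 | y ≟ 1
... | yes refl | yes refl = ∷-injectiveʳ (∷-injectiveʳ e)
... | yes refl | no y≢1 = contradiction (sym (∷-injectiveˡ e)) y≢1
... | no x≢1 | yes refl = contradiction (∷-injectiveˡ e) x≢1
... | no _ | no _ = cong₂ _∷_ (∷-injectiveˡ e) (addTwoOnes-injective (∷-injectiveʳ e))

1∷≡addTwoOnes⇒1∈ : ∀ {ys ws} → 1 ∷ ys ≡ addTwoOnes ws → 1 ∈ ys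
1∷≡addTwoOnes⇒1∈ {ws = w ∷ ws} e with w ≟ 1
1∷≡addTwoOnes⇒1∈ {ws = w ∷ ws} refl | yes _ = here refl
1∷≡addTwoOnes⇒1∈ {ws = w ∷ ws} refl | no w≢1 = contradiction refl w≢1

∷ʳ1≡addTwoOnes⇒1∈ : ∀ zs {ws} → zs ∷ʳ 1 ≡ addTwoOnes ws → 1 ∈ ws → 1 ∈ zs
∷ʳ1≡addTwoOnes⇒1∈ zs {w ∷ ws} e 1∈w∷ws with w ≟ 1
∷ʳ1≡addTwoOnes⇒1∈ [] {w ∷ ws} () 1∈w∷ws | yes _
∷ʳ1≡addTwoOnes⇒1∈ (z ∷ zs) {w ∷ ws} e 1∈w∷ws | yes _ = here (sym (∷-injectiveˡ e))
∷ʳ1≡addTwoOnes⇒1∈ [] {w ∷ ws} e 1∈w∷ws | no w≢1 = contradiction (sym (∷-injectiveˡ e)) w≢1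
∷ʳ1≡addTwoOnes⇒1∈ (z ∷ zs) {w ∷ ws} e (here refl) | no w≢1 = contradiction refl w≢1
∷ʳ1≡addTwoOnes⇒1∈ (z ∷ zs) {w ∷ ws} e (there 1∈ws) | no w≢1 = there (∷ʳ1≡addTwoOnes⇒1∈ zs (∷-injectiveʳ e) 1∈ws)

∷≡∷ʳ⇒∈ : ∀ {a b : ℕ} {ys} zs → a ∷ ys ≡ zs ∷ʳ b → ys ≢ [] → a ∈ zs
∷≡∷ʳ⇒∈ [] refl ys≢[] = contradiction refl ys≢[]
∷≡∷ʳ⇒∈ (z ∷ zs) e _ = here (∷-injectiveˡ e)

data OnesAtAnEnd : List ℕ → Set where
  front : ∀ m {q} → 1 ∉ q → Odd m → OnesAtAnEnd (replicate m 1 ++ q)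
  back  : ∀ {p} m → 1 ∉ p → Any (1 <_) p → Odd m → OnesAtAnEnd (p ++ replicate m 1)

-- 1 is the smallest part, so a block of 1s with larger parts on both sides would be a valley.
OC-odd⇒OnesAtAnEnd : ∀ {n xs} → OC n xs → ¬ 2 ∣ n → OnesAtAnEnd xs
OC-odd⇒OnesAtAnEnd oc@(mkOC _ powers u blocks) n-odd with blocks 1 (OC-odd⇒1∈ oc n-odd)
... | [] , m , q , refl , _ , 1∉q , m-odd = front m 1∉q m-odd
... | y ∷ p , m , [] , refl , 1∉y∷p , _ , m-odd =
  subst OnesAtAnEnd (cong ((y ∷ p) ++_) (sym (++-identityʳ (replicate m 1))))
    (back m 1∉y∷p (here (IsPowerOf2⇒>1 (All.head powers) (λ y≡1 → 1∉y∷p (here (sym y≡1))))) m-odd)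
... | y ∷ p , zero , q₀ ∷ q , refl , _ , _ , m-odd = contradiction m-odd ¬Odd-0
... | y ∷ p , suc m , q₀ ∷ q , refl , 1∉y∷p , 1∉q₀∷q , _ =
  contradiction (Any.++⁺ʳ (replicate m 1) (here 1<q₀))
    (Unimodal-no-valley y p (replicate m 1 ++ q₀ ∷ q) u (All-IsPowerOf2⇒>1 (All.++⁻ˡ (y ∷ p) powers) 1∉y∷p))
  where
  1<q₀ : 1 < q₀
  1<q₀ = All.head (All-IsPowerOf2⇒>1 (All.++⁻ʳ (replicate (suc m) 1) (All.++⁻ʳ (y ∷ p) powers)) 1∉q₀∷q)

OC-addTwoOnes : ∀ {n ws} → ¬ 2 ∣ n → OC n ws → OC (2 + n) (addTwoOnes ws)
OC-addTwoOnes n-odd oc with OC-odd⇒OnesAtAnEnd oc n-odd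
... | front zero _ m-odd = contradiction m-odd ¬Odd-0
... | front (suc m) _ _ = OC-∷∷∷ oc
... | back zero _ _ m-odd = contradiction m-odd ¬Odd-0
... | back {p} (suc m) 1∉p 1<p _ =
  subst (OC _) (trans (sym (++-replicate-3+ p m 1)) (sym (addTwoOnes-++ p (replicate m 1) 1∉p)))
    (OC-∷ʳ∷ʳ∷ʳ (Any.++⁺ˡ 1<p) (subst (OC _) (++-replicate-suc p m 1) oc))

module OddStep (k : ℕ) where

  ByFirst ByLast ByGrowth : List ℕ → Set
  ByFirst = Image (1 ∷_) (OC (2 + 2 * k))
  ByLast = Image (_∷ʳ 1) (OC (2 + 2 * k))
  ByGrowth = Image addTwoOnes (OC (1 + 2 * k))

  split : ∀ {xs} → OC (3 + 2 * k) xs → ByFirst xs ⊎ (ByLast xs ⊎ ByGrowth xs)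
  split oc with OC-odd⇒OnesAtAnEnd oc (¬2∣3+2*k k)
  ... | front 1 {q} 1∉q _ = inj₁ (q , OC-∷⁻ 1∉q oc , refl)
  ... | front (suc (suc (suc m))) {q} _ _ = inj₂ (inj₂ (1 ∷ replicate m 1 ++ q , OC-∷∷∷⁻ oc , refl))
  ... | front 0 _ m-odd = contradiction m-odd ¬Odd-0
  ... | front 2 _ m-odd = contradiction m-odd ¬Odd-2
  ... | back {p} 1 1∉p _ _ = inj₂ (inj₁ (p , OC-∷ʳ⁻ 1∉p oc , refl))
  ... | back {p} (suc (suc (suc m))) 1∉p _ _ =
    inj₂ (inj₂ (p ++ replicate (suc m) 1 ,
      subst (OC _) (sym (++-replicate-suc p m 1)) (OC-∷ʳ∷ʳ∷ʳ⁻ (subst (OC _) (++-replicate-3+ p m 1) oc)) ,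
      sym (addTwoOnes-++ p (replicate m 1) 1∉p)))
  ... | back 0 _ _ m-odd = contradiction m-odd ¬Odd-0
  ... | back 2 _ _ m-odd = contradiction m-odd ¬Odd-2

  merge : ∀ {xs} → ByFirst xs ⊎ (ByLast xs ⊎ ByGrowth xs) → OC (3 + 2 * k) xs
  merge (inj₁ (ys , oc , refl)) = OC-∷ (OC-even⇒1∉ oc (2∣2+2*k k)) oc
  merge (inj₂ (inj₁ (ys , oc , refl))) = OC-∷ʳ 1∉ys (1∉⇒Any-1< (OC.powers oc) 1∉ys (OC-suc⇒≢[] oc)) oc
    where
    1∉ys : 1 ∉ ys
    1∉ys = OC-even⇒1∉ oc (2∣2+2*k k)
  merge (inj₂ (inj₂ (ws , oc , refl))) = OC-addTwoOnes (¬2∣1+2*m k) oc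

  first∩last=∅ : ∀ {xs} → ByFirst xs → ¬ ByLast xs
  first∩last=∅ (ys , oc₁ , refl) (zs , oc₂ , e) =
    OC-even⇒1∉ oc₂ (2∣2+2*k k) (∷≡∷ʳ⇒∈ zs e (OC-suc⇒≢[] oc₁))

  first∩growth=∅ : ∀ {xs} → ByFirst xs → ¬ ByGrowth xs
  first∩growth=∅ (ys , oc₁ , refl) (ws , _ , e) = OC-even⇒1∉ oc₁ (2∣2+2*k k) (1∷≡addTwoOnes⇒1∈ {ws = ws} e)

  last∩growth=∅ : ∀ {xs} → ByLast xs → ¬ ByGrowth xs
  last∩growth=∅ (zs , oc₂ , refl) (ws , oc₃ , e) =
    OC-even⇒1∉ oc₂ (2∣2+2*k k) (∷ʳ1≡addTwoOnes⇒1∈ zs e (OC-odd⇒1∈ oc₃ (¬2∣1+2*m k)))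

  count : ∀ {a b} → HasCount (OC (2 + 2 * k)) a → HasCount (OC (1 + 2 * k)) b → HasCount (OC (3 + 2 * k)) (a + (a + b))
  count countEven countOdd = HasCount-resp merge split
    (HasCount-⊎ first∩rest=∅ (HasCount-image ∷-injectiveʳ countEven)
      (HasCount-⊎ last∩growth=∅ (HasCount-image (∷ʳ-injectiveˡ _ _) countEven) (HasCount-image addTwoOnes-injective countOdd)))
    where
    first∩rest=∅ : ∀ {xs} → ByFirst xs → ¬ (ByLast xs ⊎ ByGrowth xs)
    first∩rest=∅ first (inj₁ last) = first∩last=∅ first last
    first∩rest=∅ first (inj₂ growth) = first∩growth=∅ first growth

HasCount-OC : ∀ n → HasCount (OC n) (sp n)
HasCount-OC = <-rec (λ n → HasCount (OC n) (sp n)) step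
  where
  step : ∀ n → (∀ {m} → m < n → HasCount (OC m) (sp m)) → HasCount (OC n) (sp n)
  step n rec with parity n
  ... | even zero = HasCount-resp (λ { refl → OC-[] }) OC-0 (HasCount-≡ [])
  ... | odd zero = HasCount-resp (λ { refl → OC-[1] }) OC-1 (HasCount-≡ (1 ∷ []))
  ... | even (suc m) = subst (HasCount _) (sym (sp-double (suc m)))
    (HasCount-resp (λ { (ys , oc , refl) → OC-2* oc }) OC-2*⁻
      (HasCount-image (map-injective 2*-injective) (rec (m<m+n (suc m) z<s))))
  ... | odd (suc k) = subst (λ n → HasCount (OC n) (sp n)) 3+2k≡1+2[1+k]
    (subst (HasCount _) count≡sp (OddStep.count k (rec′ (2 + 2 * k) (n<1+n _)) (rec′ (1 + 2 * k) (<-trans (n<1+n _) (n<1+n _)))))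
    where
    3+2k≡1+2[1+k] : 3 + 2 * k ≡ 1 + 2 * suc k
    3+2k≡1+2[1+k] = cong suc (sym (*-suc 2 k))
    rec′ : ∀ m → m < 3 + 2 * k → HasCount (OC m) (sp m)
    rec′ m m<n = rec (subst (m <_) 3+2k≡1+2[1+k] m<n)
    count≡sp : sp (2 + 2 * k) + (sp (2 + 2 * k) + sp (1 + 2 * k)) ≡ sp (3 + 2 * k)
    count≡sp = trans (sym (+-assoc (sp (2 + 2 * k)) _ _))
      (trans (cong (λ a → (sp (2 + 2 * k) + a) + sp (1 + 2 * k)) (sym (+-identityʳ _))) (sym (sp-odd k)))

theorem1p2 : (n : ℕ) →
    HasCount (OCComposition n) (sp n)
    × (∀ I → n < 2 ^ I → sp n ≡ gfPartial I n)
theorem1p2 n = HasCount-resp OC⇒OCComposition OCComposition⇒OC (HasCount-OC n) , λ I → sp≡gfPartial I n
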